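{- For every positive integer $k$, let $[k]$ denote the generalized pattern $123\cdots k$ (no dashes). Then the generating function $F_{[k]}(x)$ satisfies $$F_{[k]}(x)=\sum_{j=0}^{k-1}\bigl(xF_{[k]}(x)\bigr)^j.$$
   Context: A generalized pattern is a permutation of $\{1,\dots,k\}$ written as a word $\tau_1\cdots\tau_k$ in which each pair of adjacent letters may or may not be separated by a dash "-". A permutation $\pi=\pi_1\cdots\pi_n\in S_n$ contains $\tau$ if there are indices $i_1<\dots<i_k$ with $(\pi_{i_1},\dots,\pi_{i_k})$ order-isomorphic to $(\tau_1,\dots,\tau_k)$ and $i_{j+1}=i_j+1$ whenever $\tau_j,\tau_{j+1}$ are not separated by a dash; otherwise $\pi$ avoids $\tau$. Thus $123\cdots k$ (no dashes) requires $k$ consecutive increasing entries, and $1\mbox{ - }3\mbox{ - }2$ is the classical pattern $132$. $F_\tau(x)=\sum_{n\geq0}f_\tau(n)x^n$, where $f_\tau(n)$ is the number of permutations in $S_n$ ($S_0$ = the empty permutation) avoiding both $1\mbox{ - }3\mbox{ - }2$ and $\tau$. -}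

module Defs where

open import Data.Nat using (ℕ; zero; suc; _+_; _*_; _∸_; _≤_; _<_; _≤?_; _<?_)
open import Data.Fin using (Fin; toℕ) renaming (_≟_ to _≟ᶠ_)
open import Data.Fin.Properties using (any?; all?)
open import Data.Vec using (Vec; []; _∷_; lookup)
open import Data.List using (List; []; _∷_; [_]; map; concatMap; allFin; filter; length; upTo)
open import Data.Nat.ListAction using (sum)
open import Data.Product using (Σ; ∃; ∃-syntax; _×_; _,_)
open import Relation.Nullary using (Dec; ¬_; yes; no)
open import Relation.Nullary.Decidable using (_×-dec_; ¬?)
open import Relation.Binary.PropositionalEquality using (_≡_)

-- A permutation of length n is represented (0-based) by its one-line
-- notation: a vector of n values in Fin n which is injective.
IsPerm : ∀ {n} → Vec (Fin n) n → Set
IsPerm {n} v = (i j : Fin n) → lookup v i ≡ lookup v j → i ≡ j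

isPerm? : ∀ {n} (v : Vec (Fin n) n) → Dec (IsPerm v)
isPerm? v = all? λ i → all? λ j → dec i j
  where
  dec : ∀ i j → Dec (lookup v i ≡ lookup v j → _ ≡ _)
  dec i j with lookup v i ≟ᶠ lookup v j | i ≟ᶠ j
  ... | _      | yes i≡j = yes (λ _ → i≡j)
  ... | no ne  | no _    = yes (λ e → Relation.Nullary.contradiction e ne)
  ... | yes e  | no ni≢j = no (λ f → ni≢j (f e))

val : ∀ {n} → Vec (Fin n) n → Fin n → ℕ
val v i = toℕ (lookup v i)

-- position-indexed access with ℕ index (default 0 out of range; only used in range)
at : ∀ {m n} → Vec (Fin m) n → ℕ → ℕ
at []       _       = 0
at (x ∷ v)  zero    = toℕ x
at (x ∷ v)  (suc i) = at v i

Contains132 : ∀ {n} → Vec (Fin n) n → Set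
Contains132 {n} v = ∃[ i ] ∃[ j ] ∃[ l ]
  (toℕ i < toℕ j × toℕ j < toℕ l × val v i < val v l × val v l < val v j)

contains132? : ∀ {n} (v : Vec (Fin n) n) → Dec (Contains132 v)
contains132? v = any? λ i → any? λ j → any? λ l →
  (toℕ i <? toℕ j) ×-dec (toℕ j <? toℕ l) ×-dec (val v i <? val v l) ×-dec (val v l <? val v j)

ContainsInc : ℕ → ∀ {n} → Vec (Fin n) n → Set
ContainsInc k {n} v = Σ (Fin (suc n)) λ s → (toℕ s + k ≤ n) ×
  ((t : Fin k) → suc (toℕ t) < k → at v (toℕ s + toℕ t) < at v (suc (toℕ s + toℕ t)))

containsInc? : ∀ k {n} (v : Vec (Fin n) n) → Dec (ContainsInc k v)
containsInc? k {n} v = any? λ s → (toℕ s + k ≤? n) ×-dec all? λ t → step s t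
  where
  step : ∀ s t → Dec (suc (toℕ t) < k → at v (toℕ s + toℕ t) < at v (suc (toℕ s + toℕ t)))
  step s t with suc (toℕ t) <? k | at v (toℕ s + toℕ t) <? at v (suc (toℕ s + toℕ t))
  ... | _      | yes p = yes (λ _ → p)
  ... | no ¬q  | no _  = yes (λ q → Relation.Nullary.contradiction q ¬q)
  ... | yes q  | no ¬p = no (λ f → ¬p (f q))

allVecs : ∀ m n → List (Vec (Fin m) n)
allVecs m zero    = [ [] ]
allVecs m (suc n) = concatMap (λ x → map (x ∷_) (allVecs m n)) (allFin m)

Good : ℕ → ∀ {n} → Vec (Fin n) n → Set
Good k v = IsPerm v × ¬ Contains132 v × ¬ ContainsInc k v

good? : ∀ k {n} (v : Vec (Fin n) n) → Dec (Good k v)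
good? k v = isPerm? v ×-dec ¬? (contains132? v) ×-dec ¬? (containsInc? k v)

f : ℕ → ℕ → ℕ
f k n = length (filter (good? k) (allVecs n n))

-- formal power series over ℕ as coefficient sequences
Series : Set
Series = ℕ → ℕ

one : Series
one zero    = 1
one (suc _) = 0

xmul : Series → Series
xmul a zero    = 0
xmul a (suc n) = a n

_⊛_ : Series → Series → Series
(a ⊛ b) n = sum (map (λ i → a i * b (n ∸ i)) (upTo (suc n)))

pow : Series → ℕ → Series
pow a zero    = one
pow a (suc j) = a ⊛ pow a j

-- Let π be a permutation of {0, …, n} avoiding 1-3-2 and 12⋯k, with its maximum n at position p,
-- so π = L n R.  Every entry of L exceeds every entry of R (otherwise that entry of R, n and that
-- entry of L form a 1-3-2), so L is a good permutation σ of length p shifted up by n − p and R is a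
-- good permutation of length n − p; conversely every such pair gives a good π, provided the final
-- ascending run of σ followed by n is shorter than k.  The final run of π is that of R when R is
-- nonempty, and one more than that of σ when R is empty.  Hence the series G_r of good permutations
-- whose final run has length r < k satisfy
--   G₀ = 1,   G_{r+1} = x (H G_{r+1} + G_r),   H = G₀ + ⋯ + G_{k−2},   F = G₀ + ⋯ + G_{k−1}.
-- Since Σ_{r<k} (xF)^r = 1 + xF Σ_{r<k−1} (xF)^r, the powers (xF)^r satisfy the same recurrence,
-- so G_r = (xF)^r by induction on the degree, and summing over r < k gives the theorem.

module Submission where

open import Defs
open import Data.Empty using (⊥)
open import Data.Fin using (Fin; toℕ; fromℕ<) renaming (zero to fzero; suc to fsuc)
open import Data.Fin.Properties using (toℕ-injective; toℕ<n; toℕ-fromℕ<; pigeonhole)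
open import Data.List
  using (List; []; _∷_; map; upTo; applyUpTo; _++_; concatMap; filter; length; take; drop; allFin; tabulate)
open import Data.List.Properties
  using ( map-upTo; map-applyUpTo; upTo-∷ʳ; map-++; filter-≐; filter-++; filter-none; length-++; map-cong
        ; map-concatMap; concatMap-cong; concatMap-map; map-∘; map-tabulate; length-map; length-take; take++drop≡id )
open import Data.List.Relation.Unary.All as All using (All; []; _∷_)
import Data.List.Relation.Unary.All.Properties as All
open import Data.Nat
open import Data.Nat.Induction using (<-rec)
open import Data.Nat.ListAction using (sum)
open import Data.Nat.ListAction.Properties using (sum-++)
open import Data.Nat.Properties
open import Algebra.Properties.CommutativeSemigroup +-commutativeSemigroup using (interchange)
open import Data.Product using (∃; ∃-syntax; _×_; _,_; proj₁; proj₂)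
open import Data.Sum using (inj₁; inj₂)
open import Data.Vec using (Vec; []; _∷_; lookup)
open import Function using (_∘_; id)
open import Relation.Binary using (tri<; tri≈; tri>)
open import Relation.Binary.PropositionalEquality
open import Relation.Nullary using (Dec; yes; no; ¬_; _×-dec_; _→-dec_; contradiction)
open import Relation.Nullary.Decidable using (map′; ¬?)
open import Relation.Unary using (Decidable; _≐_)
open import Relation.Unary.Properties using (_∩?_; ∁?)

-- Finite sums

∑< : ℕ → (ℕ → ℕ) → ℕ
∑< n h = sum (map h (upTo n))

syntax ∑< n (λ i → e) = ∑[ i < n ] e

open ≡-Reasoning

∑-head : ∀ n h → ∑< (suc n) h ≡ h 0 + ∑< n (h ∘ suc)
∑-head n h = cong (λ xs → h 0 + sum xs)
  (trans (map-applyUpTo suc h n) (sym (map-upTo (h ∘ suc) n)))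

∑-last : ∀ n h → ∑< (suc n) h ≡ ∑< n h + h n
∑-last n h = begin
  sum (map h (upTo (suc n)))             ≡⟨ cong (sum ∘ map h) (upTo-∷ʳ n) ⟨
  sum (map h (upTo n ++ n ∷ []))         ≡⟨ cong sum (map-++ h (upTo n) (n ∷ [])) ⟩
  sum (map h (upTo n) ++ h n ∷ [])       ≡⟨ sum-++ (map h (upTo n)) (h n ∷ []) ⟩
  ∑< n h + (h n + 0)                     ≡⟨ cong (∑< n h +_) (+-identityʳ (h n)) ⟩
  ∑< n h + h n                           ∎

∑-cong : ∀ n {h h′ : ℕ → ℕ} → (∀ i → i < n → h i ≡ h′ i) → ∑< n h ≡ ∑< n h′
∑-cong zero    eq = refl
∑-cong (suc n) {h} {h′} eq = begin
  ∑< (suc n) h      ≡⟨ ∑-last n h ⟩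
  ∑< n h + h n      ≡⟨ cong₂ _+_ (∑-cong n (λ i i<n → eq i (m<n⇒m<1+n i<n))) (eq n ≤-refl) ⟩
  ∑< n h′ + h′ n    ≡⟨ ∑-last n h′ ⟨
  ∑< (suc n) h′     ∎

∑-zero : ∀ n {h : ℕ → ℕ} → (∀ i → i < n → h i ≡ 0) → ∑< n h ≡ 0
∑-zero zero    eq = refl
∑-zero (suc n) {h} eq = begin
  ∑< (suc n) h  ≡⟨ ∑-last n h ⟩
  ∑< n h + h n  ≡⟨ cong₂ _+_ (∑-zero n (λ i i<n → eq i (m<n⇒m<1+n i<n))) (eq n ≤-refl) ⟩
  0             ∎

∑-+ : ∀ n (a b : ℕ → ℕ) → ∑[ i < n ] (a i + b i) ≡ ∑< n a + ∑< n b
∑-+ zero    a b = refl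
∑-+ (suc n) a b = begin
  ∑[ i < suc n ] (a i + b i)          ≡⟨ ∑-last n _ ⟩
  ∑[ i < n ] (a i + b i) + (a n + b n) ≡⟨ cong (_+ (a n + b n)) (∑-+ n a b) ⟩
  (∑< n a + ∑< n b) + (a n + b n)      ≡⟨ interchange (∑< n a) (∑< n b) (a n) (b n) ⟩
  (∑< n a + a n) + (∑< n b + b n)      ≡⟨ cong₂ _+_ (∑-last n a) (∑-last n b) ⟨
  ∑< (suc n) a + ∑< (suc n) b          ∎

∑-*ˡ : ∀ n c (h : ℕ → ℕ) → c * ∑< n h ≡ ∑[ i < n ] (c * h i)
∑-*ˡ zero    c h = *-zeroʳ c
∑-*ˡ (suc n) c h = begin
  c * ∑< (suc n) h               ≡⟨ cong (c *_) (∑-last n h) ⟩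
  c * (∑< n h + h n)             ≡⟨ *-distribˡ-+ c (∑< n h) (h n) ⟩
  c * ∑< n h + c * h n           ≡⟨ cong (_+ c * h n) (∑-*ˡ n c h) ⟩
  ∑[ i < n ] (c * h i) + c * h n ≡⟨ ∑-last n _ ⟨
  ∑[ i < suc n ] (c * h i)       ∎

∑-*ʳ : ∀ n c (h : ℕ → ℕ) → ∑< n h * c ≡ ∑[ i < n ] (h i * c)
∑-*ʳ n c h = begin
  ∑< n h * c           ≡⟨ *-comm (∑< n h) c ⟩
  c * ∑< n h           ≡⟨ ∑-*ˡ n c h ⟩
  ∑[ i < n ] (c * h i) ≡⟨ ∑-cong n (λ i _ → *-comm c (h i)) ⟩
  ∑[ i < n ] (h i * c) ∎

∑-comm : ∀ m n (h : ℕ → ℕ → ℕ) → ∑[ i < m ] ∑[ j < n ] h i j ≡ ∑[ j < n ] ∑[ i < m ] h i j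
∑-comm zero    n h = sym (∑-zero n (λ _ _ → refl))
∑-comm (suc m) n h = begin
  ∑[ i < suc m ] ∑[ j < n ] h i j                    ≡⟨ ∑-last m _ ⟩
  ∑[ i < m ] ∑[ j < n ] h i j + ∑[ j < n ] h m j     ≡⟨ cong (_+ ∑[ j < n ] h m j) (∑-comm m n h) ⟩
  ∑[ j < n ] ∑[ i < m ] h i j + ∑[ j < n ] h m j     ≡⟨ ∑-+ n _ _ ⟨
  ∑[ j < n ] (∑[ i < m ] h i j + h m j)              ≡⟨ ∑-cong n (λ j _ → ∑-last m (λ i → h i j)) ⟨
  ∑[ j < n ] ∑[ i < suc m ] h i j                    ∎

∑-reverse : ∀ n (h : ℕ → ℕ) → ∑< n h ≡ ∑[ i < n ] h (n ∸ suc i)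
∑-reverse zero    h = refl
∑-reverse (suc n) h = begin
  ∑< (suc n) h                          ≡⟨ ∑-last n h ⟩
  ∑< n h + h n                          ≡⟨ cong (_+ h n) (∑-reverse n h) ⟩
  ∑[ i < n ] h (n ∸ suc i) + h n        ≡⟨ +-comm _ (h n) ⟩
  h n + ∑[ i < n ] h (n ∸ suc i)        ≡⟨ ∑-head n _ ⟨
  ∑[ i < suc n ] h (suc n ∸ suc i)      ∎

∑-split : ∀ a b h → ∑< (a + b) h ≡ ∑< a h + ∑[ i < b ] h (a + i)
∑-split a zero    h = trans (cong (λ t → ∑< t h) (+-identityʳ a)) (sym (+-identityʳ _))
∑-split a (suc b) h = begin
  ∑< (a + suc b) h                               ≡⟨ cong (λ t → ∑< t h) (+-suc a b) ⟩
  ∑< (suc (a + b)) h                             ≡⟨ ∑-last (a + b) h ⟩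
  ∑< (a + b) h + h (a + b)                       ≡⟨ cong (_+ h (a + b)) (∑-split a b h) ⟩
  (∑< a h + ∑[ i < b ] h (a + i)) + h (a + b)    ≡⟨ +-assoc (∑< a h) _ _ ⟩
  ∑< a h + (∑[ i < b ] h (a + i) + h (a + b))    ≡⟨ cong (∑< a h +_) (∑-last b (λ i → h (a + i))) ⟨
  ∑< a h + ∑[ i < suc b ] h (a + i)              ∎

∑-pad : ∀ a b h → (∀ i → a ≤ i → h i ≡ 0) → ∑< (a + b) h ≡ ∑< a h
∑-pad a b h tail≡0 = begin
  ∑< (a + b) h                    ≡⟨ ∑-split a b h ⟩
  ∑< a h + ∑[ i < b ] h (a + i)   ≡⟨ cong (∑< a h +_) (∑-zero b (λ i _ → tail≡0 (a + i) (m≤m+n a i))) ⟩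
  ∑< a h + 0                      ≡⟨ +-identityʳ _ ⟩
  ∑< a h                          ∎

∑-single : ∀ m n h → n < m → (∀ i → i < m → i ≢ n → h i ≡ 0) → ∑< m h ≡ h n
∑-single (suc m) n h n<1+m others≡0 with m≤n⇒m<n∨m≡n (s≤s⁻¹ n<1+m)
... | inj₁ n<m = begin
  ∑< (suc m) h  ≡⟨ ∑-last m h ⟩
  ∑< m h + h m  ≡⟨ cong₂ _+_ (∑-single m n h n<m (λ i i<m → others≡0 i (m<n⇒m<1+n i<m)))
                             (others≡0 m ≤-refl (λ m≡n → <⇒≢ n<m (sym m≡n))) ⟩
  h n + 0       ≡⟨ +-identityʳ (h n) ⟩
  h n           ∎
... | inj₂ refl = begin
  ∑< (suc m) h  ≡⟨ ∑-last m h ⟩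
  ∑< m h + h m  ≡⟨ cong (_+ h m) (∑-zero m (λ i i<m → others≡0 i (m<n⇒m<1+n i<m) (<⇒≢ i<m))) ⟩
  h m           ∎

∑-triangle : ∀ n (h : ℕ → ℕ → ℕ) →
  ∑[ m < n ] ∑[ i < suc m ] h i m ≡ ∑[ i < n ] ∑[ j < n ∸ i ] h i (i + j)
∑-triangle zero    h = refl
∑-triangle (suc n) h = begin
  ∑[ m < suc n ] ∑[ i < suc m ] h i m
    ≡⟨ ∑-last n _ ⟩
  ∑[ m < n ] ∑[ i < suc m ] h i m + ∑[ i < suc n ] h i n
    ≡⟨ cong₂ _+_ (∑-triangle n h) (∑-last n _) ⟩
  ∑[ i < n ] ∑[ j < n ∸ i ] h i (i + j) + (∑[ i < n ] h i n + h n n)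
    ≡⟨ +-assoc (∑[ i < n ] ∑[ j < n ∸ i ] h i (i + j)) (∑[ i < n ] h i n) (h n n) ⟨
  (∑[ i < n ] ∑[ j < n ∸ i ] h i (i + j) + ∑[ i < n ] h i n) + h n n
    ≡⟨ cong (_+ h n n) (∑-+ n _ _) ⟨
  ∑[ i < n ] (∑[ j < n ∸ i ] h i (i + j) + h i n) + h n n
    ≡⟨ cong₂ _+_ (∑-cong n extend-row) diagonal ⟩
  ∑[ i < n ] ∑[ j < suc n ∸ i ] h i (i + j) + ∑[ j < suc n ∸ n ] h n (n + j)
    ≡⟨ ∑-last n _ ⟨
  ∑[ i < suc n ] ∑[ j < suc n ∸ i ] h i (i + j) ∎
  where
  extend-row : ∀ i → i < n →
    ∑[ j < n ∸ i ] h i (i + j) + h i n ≡ ∑[ j < suc n ∸ i ] h i (i + j)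
  extend-row i i<n = begin
    ∑[ j < n ∸ i ] h i (i + j) + h i n
      ≡⟨ cong (λ t → ∑[ j < n ∸ i ] h i (i + j) + h i t) (m+[n∸m]≡n (<⇒≤ i<n)) ⟨
    ∑[ j < n ∸ i ] h i (i + j) + h i (i + (n ∸ i))
      ≡⟨ ∑-last (n ∸ i) _ ⟨
    ∑[ j < suc (n ∸ i) ] h i (i + j)
      ≡⟨ cong (λ t → ∑[ j < t ] h i (i + j)) (+-∸-assoc 1 (<⇒≤ i<n)) ⟨
    ∑[ j < suc n ∸ i ] h i (i + j) ∎
  diagonal : h n n ≡ ∑[ j < suc n ∸ n ] h n (n + j)
  diagonal = begin
    h n n                          ≡⟨ cong (h n) (+-identityʳ n) ⟨
    h n (n + 0)                    ≡⟨ +-identityʳ _ ⟨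
    ∑[ j < 1 ] h n (n + j)         ≡⟨ cong (λ t → ∑[ j < t ] h n (n + j)) (m+n∸n≡m 1 n) ⟨
    ∑[ j < suc n ∸ n ] h n (n + j) ∎

-- Power series

⊛-comm : ∀ a b → a ⊛ b ≗ b ⊛ a
⊛-comm a b n = begin
  ∑[ i < suc n ] (a i * b (n ∸ i))                 ≡⟨ ∑-reverse (suc n) _ ⟩
  ∑[ i < suc n ] (a (n ∸ i) * b (n ∸ (n ∸ i)))     ≡⟨ ∑-cong (suc n) swap ⟩
  ∑[ i < suc n ] (b i * a (n ∸ i))                 ∎
  where
  swap : ∀ i → i < suc n → a (n ∸ i) * b (n ∸ (n ∸ i)) ≡ b i * a (n ∸ i)
  swap i i<1+n = trans (cong (λ t → a (n ∸ i) * b t) (m∸[m∸n]≡n (s≤s⁻¹ i<1+n))) (*-comm (a (n ∸ i)) (b i))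

⊛-congˡ : ∀ {a a′} b → a ≗ a′ → a ⊛ b ≗ a′ ⊛ b
⊛-congˡ b eq n = ∑-cong (suc n) (λ i _ → cong (_* b (n ∸ i)) (eq i))

⊛-identityˡ : ∀ b → one ⊛ b ≗ b
⊛-identityˡ b n = begin
  ∑[ i < suc n ] (one i * b (n ∸ i))   ≡⟨ ∑-head n _ ⟩
  (b n + 0) + ∑[ i < n ] 0             ≡⟨ cong₂ _+_ (+-identityʳ (b n)) (∑-zero n (λ _ _ → refl)) ⟩
  b n + 0                              ≡⟨ +-identityʳ (b n) ⟩
  b n                                  ∎

⊛-assoc : ∀ a b c → (a ⊛ b) ⊛ c ≗ a ⊛ (b ⊛ c)
⊛-assoc a b c n = begin
  ∑[ m < suc n ] (∑[ i < suc m ] (a i * b (m ∸ i)) * c (n ∸ m))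
    ≡⟨ ∑-cong (suc n) (λ m _ → ∑-*ʳ (suc m) (c (n ∸ m)) (λ i → a i * b (m ∸ i))) ⟩
  ∑[ m < suc n ] ∑[ i < suc m ] (a i * b (m ∸ i) * c (n ∸ m))
    ≡⟨ ∑-triangle (suc n) (λ i m → a i * b (m ∸ i) * c (n ∸ m)) ⟩
  ∑[ i < suc n ] ∑[ j < suc n ∸ i ] (a i * b (i + j ∸ i) * c (n ∸ (i + j)))
    ≡⟨ ∑-cong (suc n) row ⟩
  ∑[ i < suc n ] (a i * ∑[ j < suc (n ∸ i) ] (b j * c (n ∸ i ∸ j)))
    ∎
  where
  row : ∀ i → i < suc n →
    ∑[ j < suc n ∸ i ] (a i * b (i + j ∸ i) * c (n ∸ (i + j)))
      ≡ a i * ∑[ j < suc (n ∸ i) ] (b j * c (n ∸ i ∸ j))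
  row i i<1+n = begin
    ∑[ j < suc n ∸ i ] (a i * b (i + j ∸ i) * c (n ∸ (i + j)))
      ≡⟨ cong (λ t → ∑[ j < t ] (a i * b (i + j ∸ i) * c (n ∸ (i + j)))) (+-∸-assoc 1 (s≤s⁻¹ i<1+n)) ⟩
    ∑[ j < suc (n ∸ i) ] (a i * b (i + j ∸ i) * c (n ∸ (i + j)))
      ≡⟨ ∑-cong (suc (n ∸ i)) (λ j _ →
           trans (cong₂ (λ u v → a i * b u * c v) (m+n∸m≡n i j) (sym (∸-+-assoc n i j))) (*-assoc (a i) (b j) _)) ⟩
    ∑[ j < suc (n ∸ i) ] (a i * (b j * c (n ∸ i ∸ j)))
      ≡⟨ ∑-*ˡ (suc (n ∸ i)) (a i) _ ⟨
    a i * ∑[ j < suc (n ∸ i) ] (b j * c (n ∸ i ∸ j)) ∎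

_⊕_ : Series → Series → Series
(a ⊕ b) n = a n + b n

⊛-distribʳ-⊕ : ∀ a b c → (a ⊕ b) ⊛ c ≗ (a ⊛ c) ⊕ (b ⊛ c)
⊛-distribʳ-⊕ a b c n = begin
  ∑[ i < suc n ] ((a i + b i) * c (n ∸ i))
    ≡⟨ ∑-cong (suc n) (λ i _ → *-distribʳ-+ (c (n ∸ i)) (a i) (b i)) ⟩
  ∑[ i < suc n ] (a i * c (n ∸ i) + b i * c (n ∸ i))
    ≡⟨ ∑-+ (suc n) (λ i → a i * c (n ∸ i)) (λ i → b i * c (n ∸ i)) ⟩
  (a ⊛ c) n + (b ⊛ c) n ∎

⊛-∑ʳ : ∀ a K (b : ℕ → Series) → a ⊛ (λ m → ∑[ s < K ] b s m) ≗ λ n → ∑[ s < K ] (a ⊛ b s) n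
⊛-∑ʳ a K b n = begin
  ∑[ i < suc n ] (a i * ∑[ s < K ] b s (n ∸ i))   ≡⟨ ∑-cong (suc n) (λ i _ → ∑-*ˡ K (a i) _) ⟩
  ∑[ i < suc n ] ∑[ s < K ] (a i * b s (n ∸ i))   ≡⟨ ∑-comm (suc n) K _ ⟩
  ∑[ s < K ] (a ⊛ b s) n                          ∎

xmul-⊛ : ∀ a b n → (xmul a ⊛ b) (suc n) ≡ (a ⊛ b) n
xmul-⊛ a b n = ∑-head (suc n) (λ i → xmul a i * b (suc n ∸ i))

⊛-vanishingʳ : ∀ a b n → b 0 ≡ 0 → (a ⊛ b) n ≡ ∑[ i < n ] (a i * b (n ∸ i))
⊛-vanishingʳ a b n b0≡0 = begin
  ∑[ i < suc n ] (a i * b (n ∸ i))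
    ≡⟨ ∑-last n _ ⟩
  ∑[ i < n ] (a i * b (n ∸ i)) + a n * b (n ∸ n)
    ≡⟨ cong (λ t → ∑[ i < n ] (a i * b (n ∸ i)) + a n * b t) (n∸n≡0 n) ⟩
  ∑[ i < n ] (a i * b (n ∸ i)) + a n * b 0
    ≡⟨ cong (λ t → ∑[ i < n ] (a i * b (n ∸ i)) + a n * t) b0≡0 ⟩
  ∑[ i < n ] (a i * b (n ∸ i)) + a n * 0
    ≡⟨ cong (∑[ i < n ] (a i * b (n ∸ i)) +_) (*-zeroʳ (a n)) ⟩
  ∑[ i < n ] (a i * b (n ∸ i)) + 0
    ≡⟨ +-identityʳ _ ⟩
  ∑[ i < n ] (a i * b (n ∸ i)) ∎

-- The hypotheses are the coefficientwise form of G₀ = 1, G_{r+1} = x (H G_{r+1} + G_r) with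
-- H = Σ_{s<k−1} G_s, and F = Σ_{r<k} G_r.
module PowersOfXF
  (k : ℕ) (1≤k : 1 ≤ k) (F : Series) (G : ℕ → Series)
  (F≡∑G : ∀ n → F n ≡ ∑[ r < k ] G r n)
  (G₀-zero : G 0 0 ≡ 1)
  (G₀-suc : ∀ n → G 0 (suc n) ≡ 0)
  (G-zero : ∀ r → suc r < k → G (suc r) 0 ≡ 0)
  (G-suc : ∀ r n → suc r < k →
           G (suc r) (suc n) ≡ ∑[ p < n ] ((∑[ s < k ∸ 1 ] G s p) * G (suc r) (n ∸ p)) + G r n)
  where

  y : Series
  y = xmul F

  H Φ : Series
  H m = ∑[ s < k ∸ 1 ] pow y s m
  Φ m = ∑[ s < k ] pow y s m

  Φ≡1+yH : Φ ≗ one ⊕ (y ⊛ H)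
  Φ≡1+yH m = begin
    ∑[ s < k ] pow y s m                          ≡⟨ cong (λ t → ∑[ s < t ] pow y s m) (m+[n∸m]≡n 1≤k) ⟨
    ∑[ s < suc (k ∸ 1) ] pow y s m                ≡⟨ ∑-head (k ∸ 1) (λ s → pow y s m) ⟩
    one m + ∑[ s < k ∸ 1 ] (y ⊛ pow y s) m        ≡⟨ cong (one m +_) (⊛-∑ʳ y (k ∸ 1) (pow y) m) ⟨
    one m + (y ⊛ H) m                             ∎

  Φ⊛yʳ : ∀ r → Φ ⊛ pow y r ≗ pow y r ⊕ (H ⊛ pow y (suc r))
  Φ⊛yʳ r n = begin
    (Φ ⊛ pow y r) n
      ≡⟨ ⊛-congˡ (pow y r) Φ≡1+yH n ⟩
    ((one ⊕ (y ⊛ H)) ⊛ pow y r) n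
      ≡⟨ ⊛-distribʳ-⊕ one (y ⊛ H) (pow y r) n ⟩
    (one ⊛ pow y r) n + ((y ⊛ H) ⊛ pow y r) n
      ≡⟨ cong₂ _+_ (⊛-identityˡ (pow y r) n) (⊛-congˡ (pow y r) (⊛-comm y H) n) ⟩
    pow y r n + ((H ⊛ y) ⊛ pow y r) n
      ≡⟨ cong (pow y r n +_) (⊛-assoc H y (pow y r) n) ⟩
    pow y r n + (H ⊛ pow y (suc r)) n ∎

  G≡pow : ∀ n r → r < k → G r n ≡ pow y r n
  G≡pow = <-rec (λ n → ∀ r → r < k → G r n ≡ pow y r n) step
    where
    step : ∀ n → (∀ {m} → m < n → ∀ r → r < k → G r m ≡ pow y r m) → ∀ r → r < k → G r n ≡ pow y r n
    step zero    _  zero    _     = G₀-zero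
    step zero    _  (suc r) 1+r<k = G-zero r 1+r<k
    step (suc n) _  zero    _     = G₀-suc n
    step (suc n) ih (suc r) 1+r<k = begin
      G (suc r) (suc n)
        ≡⟨ G-suc r n 1+r<k ⟩
      ∑[ p < n ] ((∑[ s < k ∸ 1 ] G s p) * G (suc r) (n ∸ p)) + G r n
        ≡⟨ cong₂ _+_ (∑-cong n (λ p p<n → cong₂ _*_ (H-ih p<n) (ih (s≤s (m∸n≤m n p)) (suc r) 1+r<k)))
                     (ih ≤-refl r (<-trans (n<1+n r) 1+r<k)) ⟩
      ∑[ p < n ] (H p * pow y (suc r) (n ∸ p)) + pow y r n
        ≡⟨ cong (_+ pow y r n) (⊛-vanishingʳ H (pow y (suc r)) n refl) ⟨
      (H ⊛ pow y (suc r)) n + pow y r n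
        ≡⟨ +-comm _ (pow y r n) ⟩
      pow y r n + (H ⊛ pow y (suc r)) n
        ≡⟨ Φ⊛yʳ r n ⟨
      (Φ ⊛ pow y r) n
        ≡⟨ ∑-cong (suc n) (λ i i<1+n → cong (_* pow y r (n ∸ i)) (F≡Φ i<1+n)) ⟨
      (F ⊛ pow y r) n
        ≡⟨ xmul-⊛ F (pow y r) n ⟨
      pow y (suc r) (suc n) ∎
      where
      H-ih : ∀ {p} → p < n → ∑[ s < k ∸ 1 ] G s p ≡ H p
      H-ih p<n = ∑-cong (k ∸ 1) (λ s s<k-1 → ih (m<n⇒m<1+n p<n) s (<-≤-trans s<k-1 (m∸n≤m k 1)))
      F≡Φ : ∀ {i} → i < suc n → F i ≡ Φ i
      F≡Φ i<1+n = trans (F≡∑G _) (∑-cong k (λ s s<k → ih i<1+n s s<k))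

  F≡∑pow : ∀ n → F n ≡ ∑[ r < k ] pow (xmul F) r n
  F≡∑pow n = trans (F≡∑G n) (∑-cong k (λ r r<k → G≡pow n r r<k))

-- Counting by filtering

count : ∀ {A : Set} {P : A → Set} → Decidable P → List A → ℕ
count P? xs = length (filter P? xs)

module _ {A : Set} {P Q : A → Set} (P? : Decidable P) (Q? : Decidable Q) where

  count-≐ : P ≐ Q → ∀ xs → count P? xs ≡ count Q? xs
  count-≐ P≐Q xs = cong length (filter-≐ P? Q? P≐Q xs)

  count-∩-∁ : ∀ xs → count P? xs ≡ count (P? ∩? Q?) xs + count (P? ∩? ∁? Q?) xs
  count-∩-∁ [] = refl
  count-∩-∁ (x ∷ xs) with P? x | Q? x
  ... | no  _ | _     = count-∩-∁ xs
  ... | yes _ | yes _ = cong suc (count-∩-∁ xs)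
  ... | yes _ | no  _ = trans (cong suc (count-∩-∁ xs)) (sym (+-suc _ _))

module _ {A : Set} {P : A → Set} (P? : Decidable P) where

  count-none : (∀ x → ¬ P x) → ∀ xs → count P? xs ≡ 0
  count-none ¬P xs = cong length (filter-none P? (All.universal ¬P xs))

  count-++ : ∀ xs ys → count P? (xs ++ ys) ≡ count P? xs + count P? ys
  count-++ xs ys = trans (cong length (filter-++ P? xs ys)) (length-++ (filter P? xs))

  count-map : ∀ {B : Set} (g : B → A) xs → count P? (map g xs) ≡ count (P? ∘ g) xs
  count-map g [] = refl
  count-map g (x ∷ xs) with P? (g x)
  ... | yes _ = cong suc (count-map g xs)
  ... | no  _ = count-map g xs

  count-concatMap : ∀ {B : Set} (g : B → List A) xs → count P? (concatMap g xs) ≡ sum (map (count P? ∘ g) xs)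
  count-concatMap g []       = refl
  count-concatMap g (x ∷ xs) = trans (count-++ (g x) (concatMap g xs)) (cong (count P? (g x) +_) (count-concatMap g xs))

count-byValue : ∀ {A : Set} {P : A → Set} (P? : Decidable P) (h : A → ℕ) K xs →
  ∑[ s < K ] count (P? ∩? (λ z → h z ≟ s)) xs ≡ count (P? ∩? (λ z → h z <? K)) xs
count-byValue P? h zero xs = sym (count-none (P? ∩? (λ z → h z <? 0)) (λ _ ()) xs)
count-byValue {P = P} P? h (suc K) xs = begin
  ∑[ s < suc K ] count (P? ∩? (λ z → h z ≟ s)) xs
    ≡⟨ ∑-last K _ ⟩
  ∑[ s < K ] count (P? ∩? (λ z → h z ≟ s)) xs + count at-K xs
    ≡⟨ cong (_+ count at-K xs) (count-byValue P? h K xs) ⟩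
  count below-K xs + count at-K xs
    ≡⟨ cong₂ _+_ (count-≐ below-K _ below-K≐ xs) (count-≐ at-K _ at-K≐ xs) ⟩
  count (below-1+K ∩? h<K?) xs + count (below-1+K ∩? ∁? h<K?) xs
    ≡⟨ count-∩-∁ below-1+K h<K? xs ⟨
  count below-1+K xs ∎
  where
  h<K? : Decidable (λ z → h z < K)
  h<K? z = h z <? K
  below-K : Decidable (λ z → P z × h z < K)
  below-K = P? ∩? h<K?
  below-1+K : Decidable (λ z → P z × h z < suc K)
  below-1+K = P? ∩? (λ z → h z <? suc K)
  at-K : Decidable (λ z → P z × h z ≡ K)
  at-K = P? ∩? (λ z → h z ≟ K)
  below-K≐ : (λ z → P z × h z < K) ≐ (λ z → (P z × h z < suc K) × h z < K)
  below-K≐ = (λ (p , h<K) → (p , m<n⇒m<1+n h<K) , h<K) , λ ((p , _) , h<K) → p , h<K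
  at-K≐ : (λ z → P z × h z ≡ K) ≐ (λ z → (P z × h z < suc K) × ¬ h z < K)
  at-K≐ = (λ { (p , refl) → (p , ≤-refl) , n≮n _ }) ,
          (λ ((p , h<1+K) , h≮K) → p , ≤-antisym (s≤s⁻¹ h<1+K) (≮⇒≥ h≮K))

-- Words over a finite alphabet

words : ℕ → ℕ → List (List ℕ)
words m zero    = [] ∷ []
words m (suc n) = concatMap (λ x → map (x ∷_) (words m n)) (upTo m)

count-words-suc : ∀ {P : List ℕ → Set} (P? : Decidable P) m n →
  count P? (words m (suc n)) ≡ ∑[ x < m ] count (P? ∘ (x ∷_)) (words m n)
count-words-suc P? m n = trans (count-concatMap P? (λ x → map (x ∷_) (words m n)) (upTo m))
  (cong sum (map-cong (λ x → count-map P? (x ∷_) (words m n)) (upTo m)))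

count-words-zero : ∀ {P : List ℕ → Set} (P? : Decidable P) m → P [] → count P? (words m zero) ≡ 1
count-words-zero P? m p with P? []
... | yes _ = refl
... | no ¬p = contradiction p ¬p

count-words-++ : ∀ m p q {A B : List ℕ → Set} (A? : Decidable A) (B? : Decidable B) →
  count (λ zs → A? (take p zs) ×-dec B? (drop p zs)) (words m (p + q)) ≡ count A? (words m p) * count B? (words m q)
count-words-++ m zero q A? B? with A? []
... | yes a = trans (count-≐ _ B? (proj₂ , (a ,_)) (words m q)) (sym (+-identityʳ _))
... | no ¬a = count-none _ (λ _ → ¬a ∘ proj₁) (words m q)
count-words-++ m (suc p) q A? B? = begin
  count (λ zs → A? (take (suc p) zs) ×-dec B? (drop (suc p) zs)) (words m (suc p + q))
    ≡⟨ count-words-suc _ m (p + q) ⟩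
  ∑[ x < m ] count (λ ys → A? (x ∷ take p ys) ×-dec B? (drop p ys)) (words m (p + q))
    ≡⟨ ∑-cong m (λ x _ → count-words-++ m p q (A? ∘ (x ∷_)) B?) ⟩
  ∑[ x < m ] (count (A? ∘ (x ∷_)) (words m p) * count B? (words m q))
    ≡⟨ ∑-*ʳ m _ _ ⟨
  ∑[ x < m ] count (A? ∘ (x ∷_)) (words m p) * count B? (words m q)
    ≡⟨ cong (_* count B? (words m q)) (count-words-suc A? m p) ⟨
  count A? (words m (suc p)) * count B? (words m q) ∎

count-words-widen : ∀ m m′ n {P : List ℕ → Set} (P? : Decidable P) → m ≤ m′ →
  (∀ {ys} → P ys → All (_< m) ys) → count P? (words m n) ≡ count P? (words m′ n)
count-words-widen m m′ zero    P? _    _       = refl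
count-words-widen m m′ (suc n) P? m≤m′ bounded = begin
  count P? (words m (suc n))
    ≡⟨ count-words-suc P? m n ⟩
  ∑[ x < m ] count (P? ∘ (x ∷_)) (words m n)
    ≡⟨ ∑-cong m (λ x _ → count-words-widen m m′ n (P? ∘ (x ∷_)) m≤m′ (All.tail ∘ bounded)) ⟩
  ∑[ x < m ] count (P? ∘ (x ∷_)) (words m′ n)
    ≡⟨ ∑-pad m (m′ ∸ m) _ (λ x m≤x → count-none _ (λ _ p → <⇒≱ (All.head (bounded p)) m≤x) (words m′ n)) ⟨
  ∑[ x < m + (m′ ∸ m) ] count (P? ∘ (x ∷_)) (words m′ n)
    ≡⟨ cong (λ t → ∑[ x < t ] count (P? ∘ (x ∷_)) (words m′ n)) (m+[n∸m]≡n m≤m′) ⟩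
  ∑[ x < m′ ] count (P? ∘ (x ∷_)) (words m′ n)
    ≡⟨ count-words-suc P? m′ n ⟨
  count P? (words m′ (suc n)) ∎

Shifted : ℕ → (List ℕ → Set) → List ℕ → Set
Shifted c Q ys = All (c ≤_) ys × Q (map (_∸ c) ys)

shifted? : ∀ c {Q : List ℕ → Set} → Decidable Q → Decidable (Shifted c Q)
shifted? c Q? ys = All.all? (c ≤?_) ys ×-dec Q? (map (_∸ c) ys)

count-words-shift : ∀ c m p {Q : List ℕ → Set} (Q? : Decidable Q) →
  (∀ {ys} → Q ys → All (_< m) ys) → count (shifted? c Q?) (words (c + m) p) ≡ count Q? (words m p)
count-words-shift c m zero    Q? _ with Q? []
... | yes _ = refl
... | no  _ = refl
count-words-shift c m (suc p) {Q} Q? bounded = begin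
  count (shifted? c Q?) (words (c + m) (suc p))
    ≡⟨ count-words-suc (shifted? c Q?) (c + m) p ⟩
  ∑[ x < c + m ] count (shifted? c Q? ∘ (x ∷_)) (words (c + m) p)
    ≡⟨ ∑-split c m _ ⟩
  ∑[ x < c ] count (shifted? c Q? ∘ (x ∷_)) (words (c + m) p)
    + ∑[ i < m ] count (shifted? c Q? ∘ (c + i ∷_)) (words (c + m) p)
    ≡⟨ cong₂ _+_ (∑-zero c (λ x x<c → count-none _ (λ ys q → <⇒≱ x<c (All.head (proj₁ q))) (words (c + m) p)))
                 (∑-cong m (λ i _ → shift-head i)) ⟩
  ∑[ i < m ] count (Q? ∘ (i ∷_)) (words m p)
    ≡⟨ count-words-suc Q? m p ⟨
  count Q? (words m (suc p)) ∎
  where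
  shift-head : ∀ i → count (shifted? c Q? ∘ (c + i ∷_)) (words (c + m) p) ≡ count (Q? ∘ (i ∷_)) (words m p)
  shift-head i = trans
    (count-≐ _ (shifted? c (Q? ∘ (i ∷_)))
      ((λ { (_ ∷ c≤ys , q) → c≤ys , subst (λ t → Q (t ∷ map (_∸ c) _)) (m+n∸m≡n c i) q }) ,
       (λ (c≤ys , q) → m≤m+n c i ∷ c≤ys , subst (λ t → Q (t ∷ map (_∸ c) _)) (sym (m+n∸m≡n c i)) q))
      (words (c + m) p))
    (count-words-shift c m p (Q? ∘ (i ∷_)) (All.tail ∘ bounded))

Headed : ℕ → (List ℕ → Set) → List ℕ → Set
Headed n B []      = ⊥
Headed n B (z ∷ R) = z ≡ n × B R

headed? : ∀ n {B : List ℕ → Set} → Decidable B → Decidable (Headed n B)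
headed? n B? []      = no λ ()
headed? n B? (z ∷ R) = (z ≟ n) ×-dec B? R

count-words-headed : ∀ m n q {B : List ℕ → Set} (B? : Decidable B) → n < m →
  count (headed? n B?) (words m (suc q)) ≡ count B? (words m q)
count-words-headed m n q B? n<m = begin
  count (headed? n B?) (words m (suc q))
    ≡⟨ count-words-suc (headed? n B?) m q ⟩
  ∑[ x < m ] count (headed? n B? ∘ (x ∷_)) (words m q)
    ≡⟨ ∑-single m n _ n<m (λ x _ x≢n → count-none _ (λ _ → x≢n ∘ proj₁) (words m q)) ⟩
  count (headed? n B? ∘ (n ∷_)) (words m q)
    ≡⟨ count-≐ _ B? (proj₂ , (refl ,_)) (words m q) ⟩
  count B? (words m q) ∎

-- Good words

-- Junk value 0 outside the list: every use carries a bound on the index.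
nth : List ℕ → ℕ → ℕ
nth []       _       = 0
nth (x ∷ xs) zero    = x
nth (x ∷ xs) (suc i) = nth xs i

nth-++ˡ : ∀ xs ys {i} → i < length xs → nth (xs ++ ys) i ≡ nth xs i
nth-++ˡ (x ∷ xs) ys {zero}  _   = refl
nth-++ˡ (x ∷ xs) ys {suc i} i<n = nth-++ˡ xs ys (s≤s⁻¹ i<n)

nth-++ʳ : ∀ xs ys i → nth (xs ++ ys) (length xs + i) ≡ nth ys i
nth-++ʳ []       ys i = refl
nth-++ʳ (x ∷ xs) ys i = nth-++ʳ xs ys i

nth-map-+ : ∀ c xs {i} → i < length xs → nth (map (c +_) xs) i ≡ c + nth xs i
nth-map-+ c (x ∷ xs) {zero}  _   = refl
nth-map-+ c (x ∷ xs) {suc i} i<n = nth-map-+ c xs (s≤s⁻¹ i<n)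

All⇒nth : ∀ {P : ℕ → Set} {xs} → All P xs → ∀ {i} → i < length xs → P (nth xs i)
All⇒nth (p ∷ _)  {zero}  _   = p
All⇒nth (_ ∷ ps) {suc i} i<n = All⇒nth ps (s≤s⁻¹ i<n)

nth⇒All : ∀ {P : ℕ → Set} xs → (∀ {i} → i < length xs → P (nth xs i)) → All P xs
nth⇒All []       _ = []
nth⇒All (x ∷ xs) p = p (s≤s z≤n) ∷ nth⇒All xs (p ∘ s≤s)

Distinct : List ℕ → Set
Distinct xs = ∀ {i} → i < length xs → ∀ {j} → j < length xs → nth xs i ≡ nth xs j → i ≡ j

distinct? : ∀ xs → Dec (Distinct xs)
distinct? xs = allUpTo? (λ i → allUpTo? (λ j → (nth xs i ≟ nth xs j) →-dec (i ≟ j)) (length xs)) (length xs)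

Has132 : List ℕ → Set
Has132 xs = ∃ λ i → i < length xs × ∃ λ j → j < length xs × ∃ λ l → l < length xs ×
  (i < j × j < l × nth xs i < nth xs l × nth xs l < nth xs j)

has132? : ∀ xs → Dec (Has132 xs)
has132? xs = anyUpTo? (λ i → anyUpTo? (λ j → anyUpTo? (λ l →
  (i <? j) ×-dec (j <? l) ×-dec (nth xs i <? nth xs l) ×-dec (nth xs l <? nth xs j)) (length xs)) (length xs)) (length xs)

RisingRun : ℕ → List ℕ → ℕ → Set
RisingRun k xs s = ∀ t → suc t < k → nth xs (s + t) < nth xs (suc (s + t))

HasRun : ℕ → List ℕ → Set
HasRun k xs = ∃ λ s → s + k ≤ length xs × RisingRun k xs s

risingRun? : ∀ k xs s → Dec (RisingRun k xs s)
risingRun? k xs s = map′ (λ r t 1+t<k → r (<-trans (n<1+n t) 1+t<k) 1+t<k) (λ r {t} _ → r t)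
  (allUpTo? (λ t → (suc t <? k) →-dec (nth xs (s + t) <? nth xs (suc (s + t)))) k)

hasRun? : ∀ k xs → Dec (HasRun k xs)
hasRun? k xs = map′ (λ (s , _ , run) → s , run) (λ (s , run) → s , s≤s (≤-trans (m≤m+n s k) (proj₁ run)) , run)
  (anyUpTo? (λ s → (s + k ≤? length xs) ×-dec risingRun? k xs s) (suc (length xs)))

GoodWord : ℕ → ℕ → List ℕ → Set
GoodWord k n xs = length xs ≡ n × All (_< n) xs × Distinct xs × ¬ Has132 xs × ¬ HasRun k xs

goodWord? : ∀ k n → Decidable (GoodWord k n)
goodWord? k n xs =
  (length xs ≟ n) ×-dec All.all? (_<? n) xs ×-dec distinct? xs ×-dec ¬? (has132? xs) ×-dec ¬? (hasRun? k xs)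

toWord : ∀ {m n} → Vec (Fin m) n → List ℕ
toWord []      = []
toWord (x ∷ v) = toℕ x ∷ toWord v

length-toWord : ∀ {m n} (v : Vec (Fin m) n) → length (toWord v) ≡ n
length-toWord []      = refl
length-toWord (x ∷ v) = cong suc (length-toWord v)

toWord-bounded : ∀ {m n} (v : Vec (Fin m) n) → All (_< m) (toWord v)
toWord-bounded []      = []
toWord-bounded (x ∷ v) = toℕ<n x ∷ toWord-bounded v

at≡nth-toWord : ∀ {m n} (v : Vec (Fin m) n) i → at v i ≡ nth (toWord v) i
at≡nth-toWord []      i       = refl
at≡nth-toWord (x ∷ v) zero    = refl
at≡nth-toWord (x ∷ v) (suc i) = at≡nth-toWord v i

lookup≡nth-toWord : ∀ {m n} (v : Vec (Fin m) n) (i : Fin n) → toℕ (lookup v i) ≡ nth (toWord v) (toℕ i)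
lookup≡nth-toWord (x ∷ v) fzero    = refl
lookup≡nth-toWord (x ∷ v) (fsuc i) = lookup≡nth-toWord v i

tabulate-∘toℕ : ∀ {A : Set} m (h : ℕ → A) → tabulate (h ∘ toℕ {m}) ≡ applyUpTo h m
tabulate-∘toℕ zero    h = refl
tabulate-∘toℕ (suc m) h = cong (h 0 ∷_) (tabulate-∘toℕ m (h ∘ suc))

map-toWord-allVecs : ∀ m n → map toWord (allVecs m n) ≡ words m n
map-toWord-allVecs m zero    = refl
map-toWord-allVecs m (suc n) = begin
  map toWord (concatMap (λ x → map (x ∷_) (allVecs m n)) (allFin m))
    ≡⟨ map-concatMap toWord _ (allFin m) ⟩
  concatMap (λ x → map toWord (map (x ∷_) (allVecs m n))) (allFin m)
    ≡⟨ concatMap-cong (λ x → trans (sym (map-∘ (allVecs m n)))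
                        (trans (map-∘ (allVecs m n)) (cong (map (toℕ x ∷_)) (map-toWord-allVecs m n)))) (allFin m) ⟩
  concatMap ((λ y → map (y ∷_) (words m n)) ∘ toℕ) (allFin m)
    ≡⟨ concatMap-map (λ y → map (y ∷_) (words m n)) toℕ (allFin m) ⟨
  concatMap (λ y → map (y ∷_) (words m n)) (map toℕ (allFin m))
    ≡⟨ cong (concatMap (λ y → map (y ∷_) (words m n))) (trans (map-tabulate id toℕ) (tabulate-∘toℕ m id)) ⟩
  words m (suc n) ∎

module _ {n : ℕ} (v : Vec (Fin n) n) where
  private
    w : List ℕ
    w = toWord v

    toFin : ∀ {i} → i < length w → Fin n
    toFin {i} i<len = fromℕ< (subst (i <_) (length-toWord v) i<len)

    toℕ-toFin : ∀ {i} (i<len : i < length w) → toℕ (toFin i<len) ≡ i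
    toℕ-toFin i<len = toℕ-fromℕ< _

    toℕ<length : (i : Fin n) → toℕ i < length w
    toℕ<length i = subst (toℕ i <_) (sym (length-toWord v)) (toℕ<n i)

    val≡nth : ∀ i → val v i ≡ nth w (toℕ i)
    val≡nth = lookup≡nth-toWord v

    val-toFin : ∀ {i} (i<len : i < length w) → val v (toFin i<len) ≡ nth w i
    val-toFin i<len = trans (val≡nth (toFin i<len)) (cong (nth w) (toℕ-toFin i<len))

  isPerm⇒distinct : IsPerm v → Distinct w
  isPerm⇒distinct perm i< j< eq = begin
    _
      ≡⟨ toℕ-toFin i< ⟨
    toℕ (toFin i<)
      ≡⟨ cong toℕ (perm (toFin i<) (toFin j<) (toℕ-injective (trans (val-toFin i<) (trans eq (sym (val-toFin j<)))))) ⟩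
    toℕ (toFin j<)
      ≡⟨ toℕ-toFin j< ⟩
    _ ∎

  distinct⇒isPerm : Distinct w → IsPerm v
  distinct⇒isPerm dist i j eq = toℕ-injective
    (dist (toℕ<length i) (toℕ<length j) (trans (sym (val≡nth i)) (trans (cong toℕ eq) (val≡nth j))))

  contains132⇒has132 : Contains132 v → Has132 w
  contains132⇒has132 (i , j , l , i<j , j<l , vi<vl , vl<vj) =
    toℕ i , toℕ<length i , toℕ j , toℕ<length j , toℕ l , toℕ<length l , i<j , j<l ,
    subst₂ _<_ (val≡nth i) (val≡nth l) vi<vl , subst₂ _<_ (val≡nth l) (val≡nth j) vl<vj

  has132⇒contains132 : Has132 w → Contains132 v
  has132⇒contains132 (i , i< , j , j< , l , l< , i<j , j<l , wi<wl , wl<wj) =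
    toFin i< , toFin j< , toFin l< ,
    subst₂ _<_ (sym (toℕ-toFin i<)) (sym (toℕ-toFin j<)) i<j ,
    subst₂ _<_ (sym (toℕ-toFin j<)) (sym (toℕ-toFin l<)) j<l ,
    subst₂ _<_ (sym (val-toFin i<)) (sym (val-toFin l<)) wi<wl ,
    subst₂ _<_ (sym (val-toFin l<)) (sym (val-toFin j<)) wl<wj

  containsInc⇒hasRun : ∀ k → ContainsInc k v → HasRun k w
  containsInc⇒hasRun k (s , s+k≤n , rises) =
    toℕ s , subst (toℕ s + k ≤_) (sym (length-toWord v)) s+k≤n ,
    λ t 1+t<k → subst₂ (λ a b → nth w (toℕ s + a) < nth w (suc (toℕ s + b))) (toℕ-fromℕ< _) (toℕ-fromℕ< _)
      (subst₂ _<_ (at≡nth-toWord v _) (at≡nth-toWord v _)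
        (rises (fromℕ< (<-trans (n<1+n t) 1+t<k)) (subst (λ a → suc a < k) (sym (toℕ-fromℕ< _)) 1+t<k)))

  hasRun⇒containsInc : ∀ k → HasRun k w → ContainsInc k v
  hasRun⇒containsInc k (s , s+k≤len , run) =
    fromℕ< s<1+n , subst (λ a → a + k ≤ n) (sym (toℕ-fromℕ< s<1+n)) s+k≤n ,
    λ t 1+t<k → subst (λ a → at v (a + toℕ t) < at v (suc (a + toℕ t))) (sym (toℕ-fromℕ< s<1+n))
      (subst₂ _<_ (sym (at≡nth-toWord v _)) (sym (at≡nth-toWord v _)) (run (toℕ t) 1+t<k))
    where
    s+k≤n : s + k ≤ n
    s+k≤n = subst (s + k ≤_) (length-toWord v) s+k≤len
    s<1+n : s < suc n
    s<1+n = s≤s (≤-trans (m≤m+n s k) s+k≤n)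

  good⇒goodWord : ∀ k → Good k v → GoodWord k n w
  good⇒goodWord k (perm , ¬132 , ¬inc) =
    length-toWord v , toWord-bounded v , isPerm⇒distinct perm ,
    ¬132 ∘ has132⇒contains132 , ¬inc ∘ hasRun⇒containsInc k

  goodWord⇒good : ∀ k → GoodWord k n w → Good k v
  goodWord⇒good k (_ , _ , dist , ¬132 , ¬run) =
    distinct⇒isPerm dist , ¬132 ∘ contains132⇒has132 , ¬run ∘ containsInc⇒hasRun k

f≡count-goodWords : ∀ k n → f k n ≡ count (goodWord? k n) (words n n)
f≡count-goodWords k n = begin
  count (good? k) (allVecs n n)
    ≡⟨ count-≐ (good? k) (goodWord? k n ∘ toWord) (good⇒goodWord _ k , goodWord⇒good _ k) (allVecs n n) ⟩
  count (goodWord? k n ∘ toWord) (allVecs n n)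
    ≡⟨ count-map (goodWord? k n) toWord (allVecs n n) ⟨
  count (goodWord? k n) (map toWord (allVecs n n))
    ≡⟨ cong (count (goodWord? k n)) (map-toWord-allVecs n n) ⟩
  count (goodWord? k n) (words n n) ∎

-- Final ascending runs

Ascending : List ℕ → Set
Ascending xs = RisingRun (length xs) xs 0

ascending? : ∀ xs → Dec (Ascending xs)
ascending? xs = risingRun? (length xs) xs 0

lengthIfAscending : ∀ xs → Dec (Ascending xs) → ℕ → ℕ
lengthIfAscending xs (yes _) _ = length xs
lengthIfAscending xs (no  _) r = r

finalRun : List ℕ → ℕ
finalRun []       = 0
finalRun (x ∷ xs) = lengthIfAscending (x ∷ xs) (ascending? (x ∷ xs)) (finalRun xs)

finalRun-ascending : ∀ x xs → Ascending (x ∷ xs) → finalRun (x ∷ xs) ≡ suc (length xs)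
finalRun-ascending x xs asc with ascending? (x ∷ xs)
... | yes _    = refl
... | no ¬asc  = contradiction asc ¬asc

finalRun-nonAscending : ∀ x xs → ¬ Ascending (x ∷ xs) → finalRun (x ∷ xs) ≡ finalRun xs
finalRun-nonAscending x xs ¬asc with ascending? (x ∷ xs)
... | yes asc = contradiction asc ¬asc
... | no  _   = refl

finalRun≤length : ∀ xs → finalRun xs ≤ length xs
finalRun≤length []       = z≤n
finalRun≤length (x ∷ xs) with ascending? (x ∷ xs)
... | yes _ = ≤-refl
... | no  _ = m≤n⇒m≤1+n (finalRun≤length xs)

finalRun-∷-mono : ∀ x xs → finalRun xs ≤ finalRun (x ∷ xs)
finalRun-∷-mono x xs with ascending? (x ∷ xs)
... | yes _ = m≤n⇒m≤1+n (finalRun≤length xs)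
... | no  _ = ≤-refl

finalRun-∷-positive : ∀ x xs → 1 ≤ finalRun (x ∷ xs)
finalRun-∷-positive x []       = ≤-reflexive (sym (finalRun-ascending x [] λ { _ (s≤s ()) }))
finalRun-∷-positive x (y ∷ ys) = ≤-trans (finalRun-∷-positive y ys) (finalRun-∷-mono x (y ∷ ys))

≤finalRun⇒risingSuffix : ∀ j xs → j ≤ finalRun xs → j ≤ length xs × RisingRun j xs (length xs ∸ j)
≤finalRun⇒risingSuffix j []       j≤0 = j≤0 , λ t 1+t<j → contradiction (≤-trans 1+t<j j≤0) λ ()
≤finalRun⇒risingSuffix j (x ∷ xs) j≤fr with ascending? (x ∷ xs)
... | yes asc = j≤fr , λ t 1+t<j → asc (suc (length xs) ∸ j + t) (in-range t 1+t<j)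
  where
  in-range : ∀ t → suc t < j → suc (suc (length xs) ∸ j + t) < suc (length xs)
  in-range t 1+t<j = subst (_< suc (length xs)) (+-suc _ t)
    (<-≤-trans (+-monoʳ-< (suc (length xs) ∸ j) 1+t<j) (≤-reflexive (m∸n+n≡m j≤fr)))
... | no _ with ≤finalRun⇒risingSuffix j xs j≤fr
...   | j≤len , run = m≤n⇒m≤1+n j≤len ,
  subst (RisingRun j (x ∷ xs)) (sym (+-∸-assoc 1 j≤len)) run

risingSuffix⇒≤finalRun : ∀ j xs → j ≤ length xs → RisingRun j xs (length xs ∸ j) → j ≤ finalRun xs
risingSuffix⇒≤finalRun j []       j≤0   _   = j≤0
risingSuffix⇒≤finalRun j (x ∷ xs) j≤len run with m≤n⇒m<n∨m≡n j≤len
... | inj₂ refl  = ≤-reflexive (sym (finalRun-ascending x xs (subst (RisingRun j (x ∷ xs)) (n∸n≡0 j) run)))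
... | inj₁ j<len = ≤-trans
  (risingSuffix⇒≤finalRun j xs (s≤s⁻¹ j<len) (subst (RisingRun j (x ∷ xs)) (+-∸-assoc 1 (s≤s⁻¹ j<len)) run))
  (finalRun-∷-mono x xs)

finalRun-hasRun : ∀ k xs → k ≤ finalRun xs → HasRun k xs
finalRun-hasRun k xs k≤fr with ≤finalRun⇒risingSuffix k xs k≤fr
... | k≤len , run = length xs ∸ k , ≤-reflexive (m∸n+n≡m k≤len) , run

finalRun<k : ∀ k xs → ¬ HasRun k xs → finalRun xs < k
finalRun<k k xs ¬run = ≰⇒> (¬run ∘ finalRun-hasRun k xs)

module _ (c : ℕ) (xs : List ℕ) where
  private
    length-map-+ : length (map (c +_) xs) ≡ length xs
    length-map-+ = length-map (c +_) xs

  ascending-map-+⁻ : Ascending (map (c +_) xs) → Ascending xs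
  ascending-map-+⁻ asc t 1+t<len = +-cancelˡ-< c _ _
    (subst₂ _<_ (nth-map-+ c xs (<-trans (n<1+n t) 1+t<len)) (nth-map-+ c xs 1+t<len)
      (asc t (subst (suc t <_) (sym length-map-+) 1+t<len)))

  ascending-map-+⁺ : Ascending xs → Ascending (map (c +_) xs)
  ascending-map-+⁺ asc t 1+t<len =
    subst₂ _<_ (sym (nth-map-+ c xs (<-trans (n<1+n t) 1+t<len′))) (sym (nth-map-+ c xs 1+t<len′))
      (+-monoʳ-< c (asc t 1+t<len′))
    where
    1+t<len′ : suc t < length xs
    1+t<len′ = subst (suc t <_) length-map-+ 1+t<len

finalRun-map-+ : ∀ c xs → finalRun (map (c +_) xs) ≡ finalRun xs
finalRun-map-+ c []       = refl
finalRun-map-+ c (x ∷ xs) with ascending? (map (c +_) (x ∷ xs)) | ascending? (x ∷ xs)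
... | yes _   | yes _   = cong suc (length-map (c +_) xs)
... | no  _   | no  _   = finalRun-map-+ c xs
... | yes asc | no ¬asc = contradiction (ascending-map-+⁻ c (x ∷ xs) asc) ¬asc
... | no ¬asc | yes asc = contradiction (ascending-map-+⁺ c (x ∷ xs) asc) ¬asc

module _ (xs : List ℕ) (n : ℕ) where
  private
    length-snoc : length (xs ++ n ∷ []) ≡ suc (length xs)
    length-snoc = trans (length-++ xs) (+-comm (length xs) 1)

  ascending-snoc⁻ : Ascending (xs ++ n ∷ []) → Ascending xs
  ascending-snoc⁻ asc t 1+t<len =
    subst₂ _<_ (nth-++ˡ xs (n ∷ []) (<-trans (n<1+n t) 1+t<len)) (nth-++ˡ xs (n ∷ []) 1+t<len)
      (asc t (subst (suc t <_) (sym length-snoc) (m<n⇒m<1+n 1+t<len)))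

  ascending-snoc⁺ : All (_< n) xs → Ascending xs → Ascending (xs ++ n ∷ [])
  ascending-snoc⁺ xs<n asc t 1+t<len with m<1+n⇒m<n∨m≡n (subst (suc t <_) length-snoc 1+t<len)
  ... | inj₁ 1+t<len′ =
    subst₂ _<_ (sym (nth-++ˡ xs (n ∷ []) (<-trans (n<1+n t) 1+t<len′))) (sym (nth-++ˡ xs (n ∷ []) 1+t<len′))
      (asc t 1+t<len′)
  ... | inj₂ 1+t≡len =
    subst₂ _<_ (sym (nth-++ˡ xs (n ∷ []) t<len))
      (sym (trans (cong (nth (xs ++ n ∷ [])) (trans 1+t≡len (sym (+-identityʳ (length xs))))) (nth-++ʳ xs (n ∷ []) 0)))
      (All⇒nth xs<n t<len)
    where
    t<len : t < length xs
    t<len = subst (t <_) 1+t≡len (n<1+n t)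

finalRun-snoc : ∀ xs n → All (_< n) xs → finalRun (xs ++ n ∷ []) ≡ suc (finalRun xs)
finalRun-snoc []       n _ = finalRun-ascending n [] λ { _ (s≤s ()) }
finalRun-snoc (x ∷ xs) n xs<n@(_ ∷ xs<n′) with ascending? (x ∷ xs ++ n ∷ []) | ascending? (x ∷ xs)
... | yes _   | yes _   = cong suc (trans (length-++ xs) (+-comm (length xs) 1))
... | no  _   | no  _   = finalRun-snoc xs n xs<n′
... | yes asc | no ¬asc = contradiction (ascending-snoc⁻ (x ∷ xs) n asc) ¬asc
... | no ¬asc | yes asc = contradiction (ascending-snoc⁺ (x ∷ xs) n xs<n asc) ¬asc

descent⇒¬ascending : ∀ xs n y R → y ≤ n → ¬ Ascending (xs ++ n ∷ y ∷ R)
descent⇒¬ascending xs n y R y≤n asc = <⇒≱ (subst₂ _<_ at-n at-y (asc (length xs + 0) in-range)) y≤n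
  where
  at-n : nth (xs ++ n ∷ y ∷ R) (length xs + 0) ≡ n
  at-n = nth-++ʳ xs (n ∷ y ∷ R) 0
  at-y : nth (xs ++ n ∷ y ∷ R) (suc (length xs + 0)) ≡ y
  at-y = trans (cong (nth (xs ++ n ∷ y ∷ R)) (sym (+-suc (length xs) 0))) (nth-++ʳ xs (n ∷ y ∷ R) 1)
  in-range : suc (length xs + 0) < length (xs ++ n ∷ y ∷ R)
  in-range = subst₂ _<_ (+-suc (length xs) 0) (sym (length-++ xs)) (+-monoʳ-< (length xs) (s≤s (s≤s z≤n)))

finalRun-descent : ∀ xs n y R → y ≤ n → finalRun (xs ++ n ∷ y ∷ R) ≡ finalRun (y ∷ R)
finalRun-descent []       n y R y≤n = finalRun-nonAscending n (y ∷ R) (descent⇒¬ascending [] n y R y≤n)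
finalRun-descent (x ∷ xs) n y R y≤n =
  trans (finalRun-nonAscending x (xs ++ n ∷ y ∷ R) (descent⇒¬ascending (x ∷ xs) n y R y≤n))
        (finalRun-descent xs n y R y≤n)

-- Inserting the maximum

run-index< : ∀ {s k t m} → s + k ≤ m → suc t < k → suc (s + t) < m
run-index< {s} {k} {t} {m} s+k≤m 1+t<k = subst (_< m) (+-suc s t) (<-≤-trans (+-monoʳ-< s 1+t<k) s+k≤m)

module _ (xs ys : List ℕ) where
  private
    <ˡ : ∀ {i} → i < length xs → i < length (xs ++ ys)
    <ˡ i<len = <-≤-trans i<len (≤-trans (m≤m+n _ _) (≤-reflexive (sym (length-++ xs))))

    <ʳ : ∀ {i} → i < length ys → length xs + i < length (xs ++ ys)
    <ʳ i<len = <-≤-trans (+-monoʳ-< (length xs) i<len) (≤-reflexive (sym (length-++ xs)))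

  distinct-++⁻ˡ : Distinct (xs ++ ys) → Distinct xs
  distinct-++⁻ˡ dist i< j< eq = dist (<ˡ i<) (<ˡ j<) (trans (nth-++ˡ xs ys i<) (trans eq (sym (nth-++ˡ xs ys j<))))

  distinct-++⁻ʳ : Distinct (xs ++ ys) → Distinct ys
  distinct-++⁻ʳ dist {i} i< {j} j< eq = +-cancelˡ-≡ (length xs) i j
    (dist (<ʳ i<) (<ʳ j<) (trans (nth-++ʳ xs ys i) (trans eq (sym (nth-++ʳ xs ys j)))))

  has132-++⁺ˡ : Has132 xs → Has132 (xs ++ ys)
  has132-++⁺ˡ (i , i< , j , j< , l , l< , i<j , j<l , a<c , c<b) =
    i , <ˡ i< , j , <ˡ j< , l , <ˡ l< , i<j , j<l ,
    subst₂ _<_ (sym (nth-++ˡ xs ys i<)) (sym (nth-++ˡ xs ys l<)) a<c ,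
    subst₂ _<_ (sym (nth-++ˡ xs ys l<)) (sym (nth-++ˡ xs ys j<)) c<b

  has132-++⁺ʳ : Has132 ys → Has132 (xs ++ ys)
  has132-++⁺ʳ (i , i< , j , j< , l , l< , i<j , j<l , a<c , c<b) =
    length xs + i , <ʳ i< , length xs + j , <ʳ j< , length xs + l , <ʳ l< ,
    +-monoʳ-< (length xs) i<j , +-monoʳ-< (length xs) j<l ,
    subst₂ _<_ (sym (nth-++ʳ xs ys i)) (sym (nth-++ʳ xs ys l)) a<c ,
    subst₂ _<_ (sym (nth-++ʳ xs ys l)) (sym (nth-++ʳ xs ys j)) c<b

  hasRun-++⁺ˡ : ∀ k → HasRun k xs → HasRun k (xs ++ ys)
  hasRun-++⁺ˡ k (s , s+k≤len , run) =
    s , ≤-trans s+k≤len (≤-trans (m≤m+n _ _) (≤-reflexive (sym (length-++ xs)))) ,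
    λ t 1+t<k → let in-xs = run-index< s+k≤len 1+t<k in
      subst₂ _<_ (sym (nth-++ˡ xs ys (<-trans (n<1+n _) in-xs))) (sym (nth-++ˡ xs ys in-xs)) (run t 1+t<k)

  hasRun-++⁺ʳ : ∀ k → HasRun k ys → HasRun k (xs ++ ys)
  hasRun-++⁺ʳ k (s , s+k≤len , run) =
    length xs + s ,
    subst₂ _≤_ (sym (+-assoc (length xs) s k)) (sym (length-++ xs)) (+-monoʳ-≤ (length xs) s+k≤len) ,
    λ t 1+t<k → subst₂ _<_
      (sym (trans (cong (nth (xs ++ ys)) (+-assoc (length xs) s t)) (nth-++ʳ xs ys (s + t))))
      (sym (trans (cong (nth (xs ++ ys)) (trans (cong suc (+-assoc (length xs) s t)) (sym (+-suc (length xs) (s + t)))))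
                  (nth-++ʳ xs ys (suc (s + t)))))
      (run t 1+t<k)

module _ (c : ℕ) (σ : List ℕ) where
  private
    w : List ℕ
    w = map (c +_) σ

    length-w : length w ≡ length σ
    length-w = length-map (c +_) σ

    <σ : ∀ {i} → i < length w → i < length σ
    <σ = subst (_ <_) length-w

    <w : ∀ {i} → i < length σ → i < length w
    <w = subst (_ <_) (sym length-w)

    <-reflect : ∀ {i j} → i < length σ → j < length σ → nth w i < nth w j → nth σ i < nth σ j
    <-reflect i< j< wi<wj = +-cancelˡ-< c _ _ (subst₂ _<_ (nth-map-+ c σ i<) (nth-map-+ c σ j<) wi<wj)

    <-preserve : ∀ {i j} → i < length σ → j < length σ → nth σ i < nth σ j → nth w i < nth w j
    <-preserve i< j< σi<σj = subst₂ _<_ (sym (nth-map-+ c σ i<)) (sym (nth-map-+ c σ j<)) (+-monoʳ-< c σi<σj)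

  distinct-map-+⁻ : Distinct w → Distinct σ
  distinct-map-+⁻ dist i< j< eq =
    dist (<w i<) (<w j<) (trans (nth-map-+ c σ i<) (trans (cong (c +_) eq) (sym (nth-map-+ c σ j<))))

  distinct-map-+⁺ : Distinct σ → Distinct w
  distinct-map-+⁺ dist i< j< eq =
    dist (<σ i<) (<σ j<) (+-cancelˡ-≡ c _ _ (trans (sym (nth-map-+ c σ (<σ i<))) (trans eq (nth-map-+ c σ (<σ j<)))))

  has132-map-+⁻ : Has132 w → Has132 σ
  has132-map-+⁻ (i , i< , j , j< , l , l< , i<j , j<l , a<c , c<b) =
    i , <σ i< , j , <σ j< , l , <σ l< , i<j , j<l , <-reflect (<σ i<) (<σ l<) a<c , <-reflect (<σ l<) (<σ j<) c<b

  has132-map-+⁺ : Has132 σ → Has132 w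
  has132-map-+⁺ (i , i< , j , j< , l , l< , i<j , j<l , a<c , c<b) =
    i , <w i< , j , <w j< , l , <w l< , i<j , j<l , <-preserve i< l< a<c , <-preserve l< j< c<b

  hasRun-map-+⁻ : ∀ k → HasRun k w → HasRun k σ
  hasRun-map-+⁻ k (s , s+k≤len , run) = s , s+k≤len′ ,
    λ t 1+t<k → let in-σ = run-index< s+k≤len′ 1+t<k in <-reflect (<-trans (n<1+n _) in-σ) in-σ (run t 1+t<k)
    where
    s+k≤len′ : s + k ≤ length σ
    s+k≤len′ = subst (s + k ≤_) length-w s+k≤len

  hasRun-map-+⁺ : ∀ k → HasRun k σ → HasRun k w
  hasRun-map-+⁺ k (s , s+k≤len , run) = s , subst (s + k ≤_) (sym length-w) s+k≤len ,
    λ t 1+t<k → let in-σ = run-index< s+k≤len 1+t<k in <-preserve (<-trans (n<1+n _) in-σ) in-σ (run t 1+t<k)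

map-+-∸ : ∀ c xs → All (c ≤_) xs → map (c +_) (map (_∸ c) xs) ≡ xs
map-+-∸ c []       []            = refl
map-+-∸ c (x ∷ xs) (c≤x ∷ c≤xs) = cong₂ _∷_ (m+[n∸m]≡n c≤x) (map-+-∸ c xs c≤xs)

distinct⇒length≤ : ∀ a w xs → Distinct xs →
  (∀ {i} → i < length xs → a ≤ nth xs i × nth xs i < a + w) → length xs ≤ w
distinct⇒length≤ a w xs dist range = ≮⇒≥ collision
  where
  a≤ : (i : Fin (length xs)) → a ≤ nth xs (toℕ i)
  a≤ i = proj₁ (range (toℕ<n i))
  offset< : (i : Fin (length xs)) → nth xs (toℕ i) ∸ a < w
  offset< i = subst (_ <_) (m+n∸m≡n a w) (∸-monoˡ-< (proj₂ (range (toℕ<n i))) (a≤ i))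
  slot : Fin (length xs) → Fin w
  slot i = fromℕ< (offset< i)
  collision : ¬ w < length xs
  collision w<len with pigeonhole w<len slot
  ... | i , j , i<j , same-slot = <⇒≢ i<j (dist (toℕ<n i) (toℕ<n j) (∸-cancelʳ-≡ (a≤ i) (a≤ j)
    (trans (sym (toℕ-fromℕ< (offset< i))) (trans (cong toℕ same-slot) (toℕ-fromℕ< (offset< j))))))

module AroundMax (L : List ℕ) (n : ℕ) (R : List ℕ) where

  π : List ℕ
  π = L ++ n ∷ R

  length-π : length π ≡ suc (length L + length R)
  length-π = trans (length-++ L) (+-suc (length L) (length R))

  data Position (i : ℕ) : Set where
    inL   : i < length L → Position i
    atMax : i ≡ length L → Position i
    inR   : ∀ j → i ≡ suc (length L + j) → j < length R → Position i

  position : ∀ {i} → i < length π → Position i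
  position {i} i<len with <-cmp i (length L)
  ... | tri< i<L _ _ = inL i<L
  ... | tri≈ _ i≡L _ = atMax i≡L
  ... | tri> _ _ L<i = inR (i ∸ suc (length L)) (sym (m+[n∸m]≡n L<i))
    (+-cancelˡ-< (suc (length L)) _ _ (subst₂ _<_ (sym (m+[n∸m]≡n L<i)) length-π i<len))

  nth-inL : ∀ {i} → i < length L → nth π i ≡ nth L i
  nth-inL = nth-++ˡ L (n ∷ R)

  nth-atMax : nth π (length L) ≡ n
  nth-atMax = trans (cong (nth π) (sym (+-identityʳ (length L)))) (nth-++ʳ L (n ∷ R) 0)

  nth-inR : ∀ j → nth π (suc (length L + j)) ≡ nth R j
  nth-inR j = trans (cong (nth π) (sym (+-suc (length L) j))) (nth-++ʳ L (n ∷ R) (suc j))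

  atMax< : length L < length π
  atMax< = subst (length L <_) (sym length-π) (s≤s (m≤m+n _ _))

  inL< : ∀ {i} → i < length L → i < length π
  inL< i<L = <-trans i<L atMax<

  inR< : ∀ {j} → j < length R → suc (length L + j) < length π
  inR< j<R = subst (_ <_) (sym length-π) (s≤s (+-monoʳ-< (length L) j<R))

  runEndingAtMax≤ : ∀ {k s} → s + k ≡ suc (length L) → RisingRun k π s → k ≤ suc (finalRun L)
  runEndingAtMax≤ {zero}          _    _   = z≤n
  runEndingAtMax≤ {suc j} {s} ends run = s≤s (risingSuffix⇒≤finalRun j L j≤L rising)
    where
    s+j≡L : s + j ≡ length L
    s+j≡L = suc-injective (trans (sym (+-suc s j)) ends)
    j≤L : j ≤ length L
    j≤L = subst (j ≤_) s+j≡L (m≤n+m j s)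
    L-j≡s : length L ∸ j ≡ s
    L-j≡s = trans (cong (_∸ j) (sym s+j≡L)) (m+n∸n≡m s j)
    rising : RisingRun j L (length L ∸ j)
    rising t 1+t<j = subst (λ m → nth L (m + t) < nth L (suc (m + t))) (sym L-j≡s)
      (subst₂ _<_ (nth-inL (<-trans (n<1+n _) in-L)) (nth-inL in-L) (run t (<-trans 1+t<j (n<1+n j))))
      where
      in-L : suc (s + t) < length L
      in-L = subst (suc (s + t) <_) s+j≡L (run-index< ≤-refl 1+t<j)

  runToMax : All (_< n) L → ∀ {k} → 1 ≤ k → k ≤ suc (finalRun L) → HasRun k π
  runToMax L<n {suc j} _ 1+j≤1+fr = length L ∸ j , subst (_≤ length π) (sym s+1+j≡1+L) atMax< , rising
    where
    suffix : j ≤ length L × RisingRun j L (length L ∸ j)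
    suffix = ≤finalRun⇒risingSuffix j L (s≤s⁻¹ 1+j≤1+fr)
    s+j≡L : length L ∸ j + j ≡ length L
    s+j≡L = m∸n+n≡m (proj₁ suffix)
    s+1+j≡1+L : length L ∸ j + suc j ≡ suc (length L)
    s+1+j≡1+L = trans (+-suc _ j) (cong suc s+j≡L)
    rising : RisingRun (suc j) π (length L ∸ j)
    rising t 1+t<1+j with m≤n⇒m<n∨m≡n (s≤s⁻¹ 1+t<1+j)
    ... | inj₁ 1+t<j = subst₂ _<_ (sym (nth-inL (<-trans (n<1+n _) in-L))) (sym (nth-inL in-L)) (proj₂ suffix t 1+t<j)
      where
      in-L : suc (length L ∸ j + t) < length L
      in-L = subst (suc (length L ∸ j + t) <_) s+j≡L (run-index< ≤-refl 1+t<j)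
    ... | inj₂ 1+t≡j =
      subst₂ _<_ (sym (nth-inL last<L)) (trans (sym nth-atMax) (cong (nth π) (sym last+1≡L))) (All⇒nth L<n last<L)
      where
      last+1≡L : suc (length L ∸ j + t) ≡ length L
      last+1≡L = trans (sym (+-suc _ t)) (trans (cong (length L ∸ j +_) 1+t≡j) s+j≡L)
      last<L : length L ∸ j + t < length L
      last<L = subst (length L ∸ j + t <_) last+1≡L (n<1+n _)

  module Compose (k : ℕ) (R≤n : length R ≤ n)
    (R≤L : All (length R ≤_) L) (L<n : All (_< n) L) (R<R : All (_< length R) R)
    (distinct-L : Distinct L) (distinct-R : Distinct R)
    (¬132-L : ¬ Has132 L) (¬132-R : ¬ Has132 R)
    (¬run-L : ¬ HasRun k L) (¬run-R : ¬ HasRun k R)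
    (finalRun-L : suc (finalRun L) < k) where

    private
      inL-≥ : ∀ {i} → i < length L → length R ≤ nth π i
      inL-≥ i<L = subst (length R ≤_) (sym (nth-inL i<L)) (All⇒nth R≤L i<L)

      inL-< : ∀ {i} → i < length L → nth π i < n
      inL-< i<L = subst (_< n) (sym (nth-inL i<L)) (All⇒nth L<n i<L)

      inR-< : ∀ {j} → j < length R → nth π (suc (length L + j)) < length R
      inR-< {j} j<R = subst (_< length R) (sym (nth-inR j)) (All⇒nth R<R j<R)

    π≤n : ∀ {i} → i < length π → nth π i ≤ n
    π≤n i<len with position i<len
    ... | inL i<L        = <⇒≤ (inL-< i<L)
    ... | atMax refl     = ≤-reflexive nth-atMax
    ... | inR j refl j<R = ≤-trans (<⇒≤ (inR-< j<R)) R≤n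

    π-bounded : All (_< suc n) π
    π-bounded = nth⇒All π (s≤s ∘ π≤n)

    distinct-π : Distinct π
    distinct-π i< j< eq with position i< | position j<
    ... | inL i<L        | inL j<L        = distinct-L i<L j<L (trans (sym (nth-inL i<L)) (trans eq (nth-inL j<L)))
    ... | inL i<L        | atMax refl     = contradiction (trans eq nth-atMax) (<⇒≢ (inL-< i<L))
    ... | inL i<L        | inR _ refl j<R = contradiction (subst (length R ≤_) eq (inL-≥ i<L)) (<⇒≱ (inR-< j<R))
    ... | atMax refl     | inL j<L        = contradiction (trans (sym eq) nth-atMax) (<⇒≢ (inL-< j<L))
    ... | atMax refl     | atMax refl     = refl
    ... | atMax refl     | inR _ refl j<R = contradiction (trans (sym eq) nth-atMax) (<⇒≢ (<-≤-trans (inR-< j<R) R≤n))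
    ... | inR _ refl i<R | inL j<L        = contradiction (subst (length R ≤_) (sym eq) (inL-≥ j<L)) (<⇒≱ (inR-< i<R))
    ... | inR _ refl i<R | atMax refl     = contradiction (trans eq nth-atMax) (<⇒≢ (<-≤-trans (inR-< i<R) R≤n))
    ... | inR i refl i<R | inR j refl j<R =
      cong (λ m → suc (length L + m)) (distinct-R i<R j<R (trans (sym (nth-inR i)) (trans eq (nth-inR j))))

    ¬132-π : ¬ Has132 π
    ¬132-π (i , i< , j , j< , l , l< , i<j , j<l , πi<πl , πl<πj) with position l<
    ... | inL l<L = ¬132-L (i , i<L , j , j<L , l , l<L , i<j , j<l ,
                            subst₂ _<_ (nth-inL i<L) (nth-inL l<L) πi<πl , subst₂ _<_ (nth-inL l<L) (nth-inL j<L) πl<πj)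
      where
      j<L = <-trans j<l l<L
      i<L = <-trans i<j j<L
    ... | atMax refl = <⇒≱ (subst (_< nth π j) nth-atMax πl<πj) (π≤n j<)
    ... | inR l′ refl l′<R with position i<
    ...   | inL i<L    = <⇒≱ πi<πl (≤-trans (<⇒≤ (inR-< l′<R)) (inL-≥ i<L))
    ...   | atMax refl = <⇒≱ (subst (_< nth π _) nth-atMax πi<πl) (π≤n l<)
    ...   | inR i′ refl i′<R with position j<
    ...     | inL j<L    = <⇒≱ (<-trans i<j j<L) (≤-trans (m≤m+n (length L) i′) (n≤1+n _))
    ...     | atMax refl = <⇒≱ i<j (≤-trans (m≤m+n (length L) i′) (n≤1+n _))
    ...     | inR j′ refl j′<R = ¬132-R (i′ , i′<R , j′ , j′<R , l′ , l′<R ,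
                                   +-cancelˡ-< (length L) _ _ (s≤s⁻¹ i<j) , +-cancelˡ-< (length L) _ _ (s≤s⁻¹ j<l) ,
                                   subst₂ _<_ (nth-inR i′) (nth-inR l′) πi<πl , subst₂ _<_ (nth-inR l′) (nth-inR j′) πl<πj)

    private
      ¬run-within-L : ∀ {s} → s + k ≤ length L → ¬ RisingRun k π s
      ¬run-within-L s+k≤L run = ¬run-L (_ , s+k≤L , λ t 1+t<k → let in-L = run-index< s+k≤L 1+t<k in
        subst₂ _<_ (nth-inL (<-trans (n<1+n _) in-L)) (nth-inL in-L) (run t 1+t<k))

      ¬run-within-R : ∀ s → suc (length L + s) + k ≤ length π → ¬ RisingRun k π (suc (length L + s))
      ¬run-within-R s in-π run = ¬run-R (s , s+k≤R , λ t 1+t<k →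
        subst₂ _<_ (trans (cong (nth π ∘ suc) (+-assoc (length L) s t)) (nth-inR (s + t)))
                   (trans (cong (nth π ∘ suc) (trans (cong suc (+-assoc (length L) s t)) (sym (+-suc (length L) (s + t)))))
                          (nth-inR (suc (s + t))))
                   (run t 1+t<k))
        where
        s+k≤R : s + k ≤ length R
        s+k≤R = +-cancelˡ-≤ (suc (length L)) _ _ (subst₂ _≤_ (+-assoc (suc (length L)) s k) length-π in-π)

      ¬run-across-max : ∀ {s} → s ≤ length L → suc (length L) < s + k → s + k ≤ length π → ¬ RisingRun k π s
      ¬run-across-max {s} s≤L crosses in-π run =
        <⇒≱ (subst (_< nth π (suc (length L))) nth-atMax
              (subst (λ m → nth π m < nth π (suc m)) (m+[n∸m]≡n s≤L) (run (length L ∸ s) 1+t<k)))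
            (π≤n (<-≤-trans crosses in-π))
        where
        1+t<k : suc (length L ∸ s) < k
        1+t<k = +-cancelˡ-< s _ _ (subst (_< s + k) (trans (cong suc (sym (m+[n∸m]≡n s≤L))) (sym (+-suc s _))) crosses)

    -- A run lies inside L, lies inside R, steps down from n, or ends at n.
    ¬run-π : ¬ HasRun k π
    ¬run-π (s , s+k≤len , run) with s + k ≤? length L
    ... | yes s+k≤L = ¬run-within-L s+k≤L run
    ... | no  s+k≰L with s ≤? length L
    ...   | no s≰L = ¬run-within-R s′ (subst (λ m → m + k ≤ length π) s≡ s+k≤len) (subst (RisingRun k π) s≡ run)
      where
      s′ : ℕ
      s′ = s ∸ suc (length L)
      s≡ : s ≡ suc (length L + s′)
      s≡ = sym (m+[n∸m]≡n (≰⇒> s≰L))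
    ...   | yes s≤L with suc (length L) <? s + k
    ...     | yes crosses = ¬run-across-max s≤L crosses s+k≤len run
    ...     | no  ¬crosses = <⇒≱ finalRun-L (runEndingAtMax≤ (≤-antisym (≮⇒≥ ¬crosses) (≰⇒> s+k≰L)) run)

  module Decompose (k : ℕ) (1≤k : 1 ≤ k) (π<1+n : All (_< suc n) π) (distinct-π : Distinct π)
    (¬132-π : ¬ Has132 π) (¬run-π : ¬ HasRun k π) (L+R≡n : length L + length R ≡ n) where

    distinct-L : Distinct L
    distinct-L = distinct-++⁻ˡ L (n ∷ R) distinct-π

    distinct-R : Distinct R
    distinct-R = distinct-++⁻ʳ (n ∷ []) R (distinct-++⁻ʳ L (n ∷ R) distinct-π)

    ¬132-L : ¬ Has132 L
    ¬132-L = ¬132-π ∘ has132-++⁺ˡ L (n ∷ R)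

    ¬132-R : ¬ Has132 R
    ¬132-R = ¬132-π ∘ has132-++⁺ʳ L (n ∷ R) ∘ has132-++⁺ʳ (n ∷ []) R

    ¬run-L : ¬ HasRun k L
    ¬run-L = ¬run-π ∘ hasRun-++⁺ˡ L (n ∷ R) k

    ¬run-R : ¬ HasRun k R
    ¬run-R = ¬run-π ∘ hasRun-++⁺ʳ L (n ∷ R) k ∘ hasRun-++⁺ʳ (n ∷ []) R k

    private
      π≤n : ∀ {i} → i < length π → nth π i ≤ n
      π≤n i<len = s≤s⁻¹ (All⇒nth π<1+n i<len)

      ≢max : ∀ {i} → i < length π → i ≢ length L → nth π i ≢ n
      ≢max i<len i≢L eq = i≢L (distinct-π i<len atMax< (trans eq (sym nth-atMax)))

      nth-L<n : ∀ {i} → i < length L → nth L i < n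
      nth-L<n {i} i<L = subst (_< n) (nth-inL i<L)
        (≤∧≢⇒< (π≤n (inL< i<L)) (≢max (inL< i<L) (<⇒≢ i<L)))

      nth-R<n : ∀ {j} → j < length R → nth R j < n
      nth-R<n {j} j<R = subst (_< n) (nth-inR j)
        (≤∧≢⇒< (π≤n (inR< j<R)) (≢max (inR< j<R) (≢-sym (<⇒≢ (s≤s (m≤m+n _ j))))))

      nth-R<L : ∀ {i j} → i < length L → j < length R → nth R j < nth L i
      nth-R<L {i} {j} i<L j<R with <-cmp (nth R j) (nth L i)
      ... | tri< R<L _ _ = R<L
      ... | tri≈ _ R≡L _ = contradiction
        (distinct-π (inL< i<L) (inR< j<R) (trans (nth-inL i<L) (trans (sym R≡L) (sym (nth-inR j)))))
        (<⇒≢ (<-trans i<L (s≤s (m≤m+n (length L) j))))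
      ... | tri> _ _ L<R = contradiction (i , inL< i<L , length L , atMax< , suc (length L + j) , inR< j<R ,
        i<L , s≤s (m≤m+n _ _) ,
        subst₂ _<_ (sym (nth-inL i<L)) (sym (nth-inR j)) L<R , subst₂ _<_ (sym (nth-inR j)) (sym nth-atMax) (nth-R<n j<R)) ¬132-π

    R≤L : All (length R ≤_) L
    R≤L = nth⇒All L λ i<L → distinct⇒length≤ 0 _ R distinct-R λ j<R → z≤n , nth-R<L i<L j<R

    L<n : All (_< n) L
    L<n = nth⇒All L nth-L<n

    -- The |L| entries of L are distinct and lie strictly between nth R j and n, while |L| + |R| = n.
    R<R : All (_< length R) R
    R<R = nth⇒All R λ {j} j<R → +-cancelˡ-≤ (length L) _ _
      (subst (length L + suc (nth R j) ≤_) (trans (m∸n+n≡m (nth-R<n j<R)) (sym L+R≡n))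
        (+-monoˡ-≤ (suc (nth R j)) (distinct⇒length≤ (suc (nth R j)) (n ∸ suc (nth R j)) L distinct-L
          λ {i} i<L → nth-R<L i<L j<R , subst (nth L i <_) (sym (m+[n∸m]≡n (nth-R<n j<R))) (nth-L<n i<L))))

    finalRun-L : suc (finalRun L) < k
    finalRun-L = ≰⇒> (¬run-π ∘ runToMax L<n 1≤k)

-- The recurrence

-- Returns length xs when n does not occur in xs.
indexOf : ℕ → List ℕ → ℕ
indexOf n []       = 0
indexOf n (x ∷ xs) with x ≟ n
... | yes _ = 0
... | no  _ = suc (indexOf n xs)

indexOf-++ : ∀ n L R → All (_< n) L → indexOf n (L ++ n ∷ R) ≡ length L
indexOf-++ n []      R _ with n ≟ n
... | yes _   = refl
... | no  n≢n = contradiction refl n≢n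
indexOf-++ n (x ∷ L) R (x<n ∷ L<n) with x ≟ n
... | yes x≡n = contradiction x≡n (<⇒≢ x<n)
... | no  _   = cong suc (indexOf-++ n L R L<n)

indexOf≤ : ∀ n xs {i} → nth xs i ≡ n → indexOf n xs ≤ i
indexOf≤ n []       {i}     _  = z≤n
indexOf≤ n (x ∷ xs) {i}     eq with x ≟ n
indexOf≤ n (x ∷ xs) {i}     eq | yes _ = z≤n
indexOf≤ n (x ∷ xs) {zero}  eq | no x≢n = contradiction eq x≢n
indexOf≤ n (x ∷ xs) {suc i} eq | no _   = s≤s (indexOf≤ n xs eq)

nth-indexOf : ∀ n xs → indexOf n xs < length xs → nth xs (indexOf n xs) ≡ n
nth-indexOf n (x ∷ xs) in-range with x ≟ n
... | yes x≡n = x≡n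
... | no  _   = nth-indexOf n xs (s≤s⁻¹ in-range)

take-nth-drop : ∀ (xs : List ℕ) {p} → p < length xs → take p xs ++ nth xs p ∷ drop (suc p) xs ≡ xs
take-nth-drop (x ∷ xs) {zero}  _        = refl
take-nth-drop (x ∷ xs) {suc p} in-range = cong (x ∷_) (take-nth-drop xs (s≤s⁻¹ in-range))

drop-nth : ∀ (xs : List ℕ) {p} → p < length xs → drop p xs ≡ nth xs p ∷ drop (suc p) xs
drop-nth (x ∷ xs) {zero}  _        = refl
drop-nth (x ∷ xs) {suc p} in-range = drop-nth xs (s≤s⁻¹ in-range)

length-take≤ : ∀ (xs : List ℕ) {p} → p ≤ length xs → length (take p xs) ≡ p
length-take≤ xs {p} p≤len = trans (length-take p xs) (m≤n⇒m⊓n≡m p≤len)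

maximum-occurs : ∀ k n xs → GoodWord k (suc n) xs → indexOf n xs < suc n
maximum-occurs k n xs (|xs|≡1+n , xs<1+n , dist , _) with anyUpTo? (λ i → nth xs i ≟ n) (length xs)
... | yes (i , i<len , xᵢ≡n) = <-≤-trans (s≤s (indexOf≤ n xs xᵢ≡n)) (subst (suc i ≤_) |xs|≡1+n i<len)
... | no  n∉xs = contradiction (subst (_≤ n) |xs|≡1+n (distinct⇒length≤ 0 n xs dist λ {i} i<len →
      z≤n , ≤∧≢⇒< (s≤s⁻¹ (All⇒nth xs<1+n i<len)) (λ xᵢ≡n → n∉xs (i , i<len , xᵢ≡n))))
    (<⇒≱ (n<1+n n))

unshift-goodWord : ∀ k c p L → All (c ≤_) L → All (_< c + p) L → length L ≡ p →
  Distinct L → ¬ Has132 L → ¬ HasRun k L → GoodWord k p (map (_∸ c) L)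
unshift-goodWord k c p L c≤L L<c+p len≡ dist ¬132 ¬run =
  trans (length-map (_∸ c) L) len≡ ,
  unshift-bounded L c≤L L<c+p ,
  distinct-map-+⁻ c σ (subst Distinct (sym L≡) dist) ,
  ¬132 ∘ subst Has132 L≡ ∘ has132-map-+⁺ c σ ,
  ¬run ∘ subst (HasRun k) L≡ ∘ hasRun-map-+⁺ c σ k
  where
  σ : List ℕ
  σ = map (_∸ c) L
  L≡ : map (c +_) σ ≡ L
  L≡ = map-+-∸ c L c≤L
  unshift-bounded : ∀ xs → All (c ≤_) xs → All (_< c + p) xs → All (_< p) (map (_∸ c) xs)
  unshift-bounded []       []           []             = []
  unshift-bounded (x ∷ xs) (c≤x ∷ c≤xs) (x<c+p ∷ xs<) =
    +-cancelˡ-< c _ _ (subst (_< c + p) (sym (m+[n∸m]≡n c≤x)) x<c+p) ∷ unshift-bounded xs c≤xs xs<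

shifted-bounded : ∀ {c p} {Q : List ℕ → Set} → (∀ {σ} → Q σ → All (_< p) σ) →
  ∀ {ys} → Shifted c Q ys → All (_< c + p) ys
shifted-bounded {c} {p} Q-bounded {ys} (c≤ys , q) =
  subst (All (_< c + p)) (map-+-∸ c ys c≤ys) (All.map⁺ (All.map (+-monoʳ-< c) (Q-bounded q)))

finalRun-unshift : ∀ c L → All (c ≤_) L → finalRun (map (_∸ c) L) ≡ finalRun L
finalRun-unshift c L c≤L = trans (sym (finalRun-map-+ c (map (_∸ c) L))) (cong finalRun (map-+-∸ c L c≤L))

take++drop-∷ : ∀ {π : List ℕ} {p n R} → drop p π ≡ n ∷ R → π ≡ take p π ++ n ∷ R
take++drop-∷ {π} {p} drop≡ = sym (trans (cong (take p π ++_) (sym drop≡)) (take++drop≡id p π))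

count-words-splitAtMax : ∀ n p → p ≤ n →
  ∀ {G QA QB : List ℕ → Set} (G? : Decidable G) (QA? : Decidable QA) (QB? : Decidable QB) →
  (∀ {σ} → QA σ → All (_< p) σ) → (∀ {R} → QB R → All (_< n ∸ p) R) →
  G ≐ (λ π → Shifted (n ∸ p) QA (take p π) × Headed n QB (drop p π)) →
  count G? (words (suc n) (suc n)) ≡ count QA? (words p p) * count QB? (words (n ∸ p) (n ∸ p))
count-words-splitAtMax n p p≤n {QA = QA} {QB} G? QA? QB? QA-bounded QB-bounded G≐ = begin
  count G? (words (suc n) (suc n))
    ≡⟨ count-≐ G? split? G≐ (words (suc n) (suc n)) ⟩
  count split? (words (suc n) (suc n))
    ≡⟨ cong (count split? ∘ words (suc n)) 1+n≡p+1+c ⟩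
  count split? (words (suc n) (p + suc c))
    ≡⟨ count-words-++ (suc n) p (suc c) (shifted? c QA?) (headed? n QB?) ⟩
  count (shifted? c QA?) (words (suc n) p) * count (headed? n QB?) (words (suc n) (suc c))
    ≡⟨ cong₂ _*_ left right ⟩
  count QA? (words p p) * count QB? (words c c) ∎
  where
  c : ℕ
  c = n ∸ p
  split? : Decidable (λ π → Shifted c QA (take p π) × Headed n QB (drop p π))
  split? π = shifted? c QA? (take p π) ×-dec headed? n QB? (drop p π)
  1+n≡p+1+c : suc n ≡ p + suc c
  1+n≡p+1+c = trans (cong suc (sym (m+[n∸m]≡n p≤n))) (sym (+-suc p c))
  left : count (shifted? c QA?) (words (suc n) p) ≡ count QA? (words p p)
  left = begin
    count (shifted? c QA?) (words (suc n) p)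
      ≡⟨ count-words-widen (c + p) (suc n) p (shifted? c QA?) c+p≤1+n (shifted-bounded QA-bounded) ⟨
    count (shifted? c QA?) (words (c + p) p)
      ≡⟨ count-words-shift c p p QA? QA-bounded ⟩
    count QA? (words p p) ∎
    where
    c+p≤1+n : c + p ≤ suc n
    c+p≤1+n = ≤-trans (≤-reflexive (trans (+-comm c p) (m+[n∸m]≡n p≤n))) (n≤1+n n)
  right : count (headed? n QB?) (words (suc n) (suc c)) ≡ count QB? (words c c)
  right = begin
    count (headed? n QB?) (words (suc n) (suc c))
      ≡⟨ count-words-headed (suc n) n c QB? (n<1+n n) ⟩
    count QB? (words (suc n) c)
      ≡⟨ count-words-widen c (suc n) c QB? (≤-trans (m∸n≤m n p) (n≤1+n n)) QB-bounded ⟨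
    count QB? (words c c) ∎

module Recurrence (k : ℕ) (1≤k : 1 ≤ k) where

  Extendable : ℕ → List ℕ → Set
  Extendable p σ = GoodWord k p σ × suc (finalRun σ) < k

  extendable? : ∀ p → Decidable (Extendable p)
  extendable? p σ = goodWord? k p σ ×-dec (suc (finalRun σ) <? k)

  extendable-bounded : ∀ {p σ} → Extendable p σ → All (_< p) σ
  extendable-bounded ((_ , σ<p , _) , _) = σ<p

  insertMax : ∀ {n p σ R} → p ≤ n → Extendable p σ → GoodWord k (n ∸ p) R →
    GoodWord k (suc n) (map ((n ∸ p) +_) σ ++ n ∷ R) × indexOf n (map ((n ∸ p) +_) σ ++ n ∷ R) ≡ p
  insertMax {n} {p} {σ} {R} p≤n ((|σ|≡p , σ<p , distinct-σ , ¬132-σ , ¬run-σ) , finalRun-σ)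
                               (|R|≡c , R<c , distinct-R , ¬132-R , ¬run-R) =
    (length≡ , π-bounded , distinct-π , ¬132-π , ¬run-π) , trans (indexOf-++ n L R L<n) |L|≡p
    where
    c : ℕ
    c = n ∸ p
    L : List ℕ
    L = map (c +_) σ
    |L|≡p : length L ≡ p
    |L|≡p = trans (length-map (c +_) σ) |σ|≡p
    c+p≡n : c + p ≡ n
    c+p≡n = trans (+-comm c p) (m+[n∸m]≡n p≤n)
    L<n : All (_< n) L
    L<n = All.map⁺ (All.map (λ {x} x<p → subst (c + x <_) c+p≡n (+-monoʳ-< c x<p)) σ<p)
    length≡ : length (L ++ n ∷ R) ≡ suc n
    length≡ = trans (AroundMax.length-π L n R) (cong suc (trans (cong₂ _+_ |L|≡p |R|≡c) (m+[n∸m]≡n p≤n)))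
    open AroundMax.Compose L n R k (subst (_≤ n) (sym |R|≡c) (m∸n≤m n p))
      (All.map⁺ (All.universal (λ x → subst (_≤ c + x) (sym |R|≡c) (m≤m+n c x)) σ)) L<n
      (subst (λ m → All (_< m) R) (sym |R|≡c) R<c)
      (distinct-map-+⁺ c σ distinct-σ) distinct-R (¬132-σ ∘ has132-map-+⁻ c σ) ¬132-R
      (¬run-σ ∘ hasRun-map-+⁻ c σ k) ¬run-R (subst (λ m → suc m < k) (sym (finalRun-map-+ c σ)) finalRun-σ)

  record MaxSplit (n p : ℕ) (π : List ℕ) : Set where
    field
      R     : List ℕ
      drop≡ : drop p π ≡ n ∷ R
      left  : Shifted (n ∸ p) (Extendable p) (take p π)
      right : GoodWord k (n ∸ p) R

  maxSplit : ∀ {n p π} → GoodWord k (suc n) π → indexOf n π ≡ p → MaxSplit n p π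
  maxSplit {n} {p} {π} good@(|π|≡1+n , π<1+n , distinct-π , ¬132-π , ¬run-π) index≡p = record
    { R     = R
    ; drop≡ = trans (drop-nth π p<|π|) (cong (_∷ R) nth≡n)
    ; left  = c≤L , unshift-goodWord k c p L c≤L L<c+p |L|≡p distinct-L ¬132-L ¬run-L ,
              subst (λ m → suc m < k) (sym (finalRun-unshift c L c≤L)) finalRun-L
    ; right = |R|≡c , subst (λ m → All (_< m) R) |R|≡c R<R , distinct-R , ¬132-R , ¬run-R
    }
    where
    p<1+n : p < suc n
    p<1+n = subst (_< suc n) index≡p (maximum-occurs k n π good)
    p≤n : p ≤ n
    p≤n = s≤s⁻¹ p<1+n
    p<|π| : p < length π
    p<|π| = subst (p <_) (sym |π|≡1+n) p<1+n
    c : ℕ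
    c = n ∸ p
    L R : List ℕ
    L = take p π
    R = drop (suc p) π
    nth≡n : nth π p ≡ n
    nth≡n = trans (cong (nth π) (sym index≡p)) (nth-indexOf n π (subst (_< length π) (sym index≡p) p<|π|))
    π≡ : π ≡ L ++ n ∷ R
    π≡ = sym (trans (cong (λ x → L ++ x ∷ R) (sym nth≡n)) (take-nth-drop π p<|π|))
    |L|≡p : length L ≡ p
    |L|≡p = length-take≤ π (<⇒≤ p<|π|)
    L+R≡n : length L + length R ≡ n
    L+R≡n = suc-injective (trans (sym (AroundMax.length-π L n R)) (trans (cong length (sym π≡)) |π|≡1+n))
    |R|≡c : length R ≡ c
    |R|≡c = trans (sym (m+n∸m≡n (length L) (length R))) (cong₂ _∸_ L+R≡n |L|≡p)
    open AroundMax.Decompose L n R k 1≤k (subst (All (_< suc n)) π≡ π<1+n) (subst Distinct π≡ distinct-π)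
      (¬132-π ∘ subst Has132 (sym π≡)) (¬run-π ∘ subst (HasRun k) (sym π≡)) L+R≡n
    c≤L : All (c ≤_) L
    c≤L = subst (λ m → All (m ≤_) L) |R|≡c R≤L
    L<c+p : All (_< c + p) L
    L<c+p = subst (λ m → All (_< m) L) (sym (trans (+-comm c p) (m+[n∸m]≡n p≤n))) L<n

  WithRun : ℕ → ℕ → List ℕ → Set
  WithRun r N π = GoodWord k N π × finalRun π ≡ r

  withRun? : ∀ r N → Decidable (WithRun r N)
  withRun? r N π = goodWord? k N π ×-dec (finalRun π ≟ r)

  headed-view : ∀ {n B} ys → Headed n B ys → ∃[ R ] (ys ≡ n ∷ R × B R)
  headed-view (_ ∷ R) (refl , b) = R , refl , b

  maxNotLast : ∀ r {n p} → p < n → (λ π → WithRun (suc r) (suc n) π × indexOf n π ≡ p) ≐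
    (λ π → Shifted (n ∸ p) (Extendable p) (take p π) × Headed n (WithRun (suc r) (n ∸ p)) (drop p π))
  maxNotLast r {n} {p} p<n = split , merge
    where
    finalRun-R : ∀ {π R} → drop p π ≡ n ∷ R → GoodWord k (n ∸ p) R → finalRun π ≡ finalRun R
    finalRun-R {π} {R} drop≡ (|R|≡c , R<c , _) with R | |R|≡c | R<c
    ... | []     | 0≡c | _ = contradiction 0≡c (<⇒≢ (m<n⇒0<n∸m p<n))
    ... | y ∷ R′ | _     | y<c ∷ _ = trans (cong finalRun (take++drop-∷ {π} {p} drop≡))
      (finalRun-descent (take p π) n y R′ (<⇒≤ (<-≤-trans y<c (m∸n≤m n p))))
    split : ∀ {π} → WithRun (suc r) (suc n) π × indexOf n π ≡ p → _
    split {π} ((good , run≡) , index≡) =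
      left , subst (Headed n _) (sym drop≡) (refl , right , trans (sym (finalRun-R drop≡ right)) run≡)
      where open MaxSplit (maxSplit good index≡)
    merge : ∀ {π} → _ → WithRun (suc r) (suc n) π × indexOf n π ≡ p
    merge {π} (left , headed) with headed-view (drop p π) headed
    ... | R , drop≡ , (goodR , runR≡) =
      (subst (GoodWord k (suc n)) (sym π≡) (proj₁ inserted) , trans (finalRun-R drop≡ goodR) runR≡) ,
      trans (cong (indexOf n) π≡) (proj₂ inserted)
      where
      σ : List ℕ
      σ = map (_∸ (n ∸ p)) (take p π)
      inserted : GoodWord k (suc n) (map ((n ∸ p) +_) σ ++ n ∷ R) × indexOf n (map ((n ∸ p) +_) σ ++ n ∷ R) ≡ p
      inserted = insertMax (<⇒≤ p<n) (proj₂ left) goodR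
      π≡ : π ≡ map ((n ∸ p) +_) σ ++ n ∷ R
      π≡ = trans (take++drop-∷ drop≡) (cong (_++ n ∷ R) (sym (map-+-∸ (n ∸ p) (take p π) (proj₁ left))))

  maxLast : ∀ r n → (λ π → WithRun (suc r) (suc n) π × indexOf n π ≡ n) ≐
    (λ π → Shifted (n ∸ n) (λ σ → Extendable n σ × finalRun σ ≡ r) (take n π)
         × Headed n (GoodWord k (n ∸ n)) (drop n π))
  maxLast r n = split , merge
    where
    finalRun-L : ∀ {π R} → drop n π ≡ n ∷ R → Shifted (n ∸ n) (Extendable n) (take n π) → GoodWord k (n ∸ n) R →
      finalRun π ≡ suc (finalRun (map (_∸ (n ∸ n)) (take n π)))
    finalRun-L {π} {R} drop≡ (c≤L , ext) (|R|≡0 , _) with R | |R|≡0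
    ... | y ∷ _ | 1+|R|≡0 = contradiction (trans 1+|R|≡0 (n∸n≡0 n)) λ ()
    ... | []    | _       = begin
      finalRun π                                           ≡⟨ cong finalRun (take++drop-∷ {π} {n} drop≡) ⟩
      finalRun (take n π ++ n ∷ [])                        ≡⟨ finalRun-snoc (take n π) n L<n ⟩
      suc (finalRun (take n π))                            ≡⟨ cong suc (finalRun-unshift (n ∸ n) (take n π) c≤L) ⟨
      suc (finalRun (map (_∸ (n ∸ n)) (take n π)))         ∎
      where
      L<n : All (_< n) (take n π)
      L<n = subst (λ m → All (_< m) (take n π)) (trans (+-comm (n ∸ n) n) (m+[n∸m]≡n ≤-refl))
        (shifted-bounded {Q = Extendable n} extendable-bounded (c≤L , ext))
    split : ∀ {π} → WithRun (suc r) (suc n) π × indexOf n π ≡ n → _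
    split {π} ((good , run≡) , index≡) =
      (proj₁ left , proj₂ left , suc-injective (trans (sym (finalRun-L drop≡ left right)) run≡)) ,
      subst (Headed n _) (sym drop≡) (refl , right)
      where open MaxSplit (maxSplit good index≡)
    merge : ∀ {π} → _ → WithRun (suc r) (suc n) π × indexOf n π ≡ n
    merge {π} ((c≤L , ext , run≡) , headed) with headed-view (drop n π) headed
    ... | R , drop≡ , goodR =
      (subst (GoodWord k (suc n)) (sym π≡) (proj₁ inserted) ,
       trans (finalRun-L drop≡ (c≤L , ext) goodR) (cong suc run≡)) ,
      trans (cong (indexOf n) π≡) (proj₂ inserted)
      where
      σ : List ℕ
      σ = map (_∸ (n ∸ n)) (take n π)
      inserted : GoodWord k (suc n) (map ((n ∸ n) +_) σ ++ n ∷ R) × indexOf n (map ((n ∸ n) +_) σ ++ n ∷ R) ≡ n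
      inserted = insertMax ≤-refl ext goodR
      π≡ : π ≡ map ((n ∸ n) +_) σ ++ n ∷ R
      π≡ = trans (take++drop-∷ drop≡) (cong (_++ n ∷ R) (sym (map-+-∸ (n ∸ n) (take n π) c≤L)))

  g : ℕ → ℕ → ℕ
  g r N = count (withRun? r N) (words N N)

  goodWord-[] : GoodWord k 0 []
  goodWord-[] = refl , [] , (λ ()) , (λ { (_ , () , _) }) ,
    λ (s , s+k≤0 , _) → contradiction (≤-trans 1≤k (≤-trans (m≤n+m k s) s+k≤0)) λ ()

  f≡∑g : ∀ N → f k N ≡ ∑[ r < k ] g r N
  f≡∑g N = begin
    f k N
      ≡⟨ f≡count-goodWords k N ⟩
    count (goodWord? k N) (words N N)
      ≡⟨ count-≐ _ _ ((λ {π} good@(_ , _ , _ , _ , ¬run) → good , finalRun<k k π ¬run) , proj₁) (words N N) ⟩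
    count (goodWord? k N ∩? (λ π → finalRun π <? k)) (words N N)
      ≡⟨ count-byValue (goodWord? k N) finalRun k (words N N) ⟨
    ∑[ r < k ] g r N ∎

  g₀-zero : g 0 0 ≡ 1
  g₀-zero = count-words-zero (withRun? 0 0) 0 (goodWord-[] , refl)

  g₀-suc : ∀ N → g 0 (suc N) ≡ 0
  g₀-suc N = count-none (withRun? 0 (suc N)) no-word (words (suc N) (suc N))
    where
    no-word : ∀ π → ¬ WithRun 0 (suc N) π
    no-word (x ∷ xs) (_ , run≡0) = contradiction (subst (1 ≤_) run≡0 (finalRun-∷-positive x xs)) λ ()

  g-zero : ∀ r → g (suc r) 0 ≡ 0
  g-zero r = count-none (withRun? (suc r) 0) no-word (words 0 0)
    where
    no-word : ∀ π → ¬ WithRun (suc r) 0 π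
    no-word [] (_ , ())

  extendable≡∑g : ∀ p → count (extendable? p) (words p p) ≡ ∑[ s < k ∸ 1 ] g s p
  extendable≡∑g p = begin
    count (extendable? p) (words p p)
      ≡⟨ count-≐ _ _ ((λ (good , fr<) → good , to fr<) , λ (good , fr<) → good , from fr<) (words p p) ⟩
    count (goodWord? k p ∩? (λ σ → finalRun σ <? k ∸ 1)) (words p p)
      ≡⟨ count-byValue (goodWord? k p) finalRun (k ∸ 1) (words p p) ⟨
    ∑[ s < k ∸ 1 ] g s p ∎
    where
    to : ∀ {m} → suc m < k → m < k ∸ 1
    to = ∸-monoˡ-≤ 1
    from : ∀ {m} → m < k ∸ 1 → suc m < k
    from {m} m<k-1 = subst (suc m <_) (m+[n∸m]≡n 1≤k) (s≤s m<k-1)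

  module _ (r n : ℕ) where
    private
      W : List (List ℕ)
      W = words (suc n) (suc n)

      maxAt? : ∀ p → Decidable (λ π → WithRun (suc r) (suc n) π × indexOf n π ≡ p)
      maxAt? p = withRun? (suc r) (suc n) ∩? (λ π → indexOf n π ≟ p)

    count-maxNotLast : ∀ {p} → p < n → count (maxAt? p) W ≡ (∑[ s < k ∸ 1 ] g s p) * g (suc r) (n ∸ p)
    count-maxNotLast {p} p<n = begin
      count (maxAt? p) W
        ≡⟨ count-words-splitAtMax n p (<⇒≤ p<n) (maxAt? p) (extendable? p) (withRun? (suc r) (n ∸ p))
             extendable-bounded (proj₁ ∘ proj₂ ∘ proj₁) (maxNotLast r p<n) ⟩
      count (extendable? p) (words p p) * g (suc r) (n ∸ p)
        ≡⟨ cong (_* g (suc r) (n ∸ p)) (extendable≡∑g p) ⟩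
      (∑[ s < k ∸ 1 ] g s p) * g (suc r) (n ∸ p) ∎

    count-maxLast : suc r < k → count (maxAt? n) W ≡ g r n
    count-maxLast 1+r<k = begin
      count (maxAt? n) W
        ≡⟨ count-words-splitAtMax n n ≤-refl (maxAt? n) extendableWithRun? (goodWord? k (n ∸ n))
             (extendable-bounded ∘ proj₁) (proj₁ ∘ proj₂) (maxLast r n) ⟩
      count extendableWithRun? (words n n) * count (goodWord? k (n ∸ n)) (words (n ∸ n) (n ∸ n))
        ≡⟨ cong (count extendableWithRun? (words n n) *_) only-[] ⟩
      count extendableWithRun? (words n n) * 1
        ≡⟨ *-identityʳ _ ⟩
      count extendableWithRun? (words n n)
        ≡⟨ count-≐ _ _ ((λ ((good , _) , run≡) → good , run≡) ,
                        (λ (good , run≡) → (good , subst (λ m → suc m < k) (sym run≡) 1+r<k) , run≡)) (words n n) ⟩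
      g r n ∎
      where
      extendableWithRun? : Decidable (λ σ → Extendable n σ × finalRun σ ≡ r)
      extendableWithRun? = extendable? n ∩? (λ σ → finalRun σ ≟ r)
      only-[] : count (goodWord? k (n ∸ n)) (words (n ∸ n) (n ∸ n)) ≡ 1
      only-[] = subst (λ m → count (goodWord? k m) (words m m) ≡ 1) (sym (n∸n≡0 n))
        (count-words-zero (goodWord? k 0) 0 goodWord-[])

    g-suc : suc r < k → g (suc r) (suc n) ≡ ∑[ p < n ] ((∑[ s < k ∸ 1 ] g s p) * g (suc r) (n ∸ p)) + g r n
    g-suc 1+r<k = begin
      g (suc r) (suc n)
        ≡⟨ count-≐ _ _ ((λ {π} w → w , maximum-occurs k n π (proj₁ w)) , proj₁) W ⟩
      count (withRun? (suc r) (suc n) ∩? (λ π → indexOf n π <? suc n)) W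
        ≡⟨ count-byValue (withRun? (suc r) (suc n)) (indexOf n) (suc n) W ⟨
      ∑[ p < suc n ] count (maxAt? p) W
        ≡⟨ ∑-last n _ ⟩
      ∑[ p < n ] count (maxAt? p) W + count (maxAt? n) W
        ≡⟨ cong₂ _+_ (∑-cong n (λ p → count-maxNotLast)) (count-maxLast 1+r<k) ⟩
      ∑[ p < n ] ((∑[ s < k ∸ 1 ] g s p) * g (suc r) (n ∸ p)) + g r n ∎

theorem2p5 : (k : ℕ) → 1 ≤ k → (n : ℕ) →
    f k n ≡ sum (map (λ j → pow (xmul (f k)) j n) (upTo k))
theorem2p5 k 1≤k = F≡∑pow
  where
  open Recurrence k 1≤k
  open PowersOfXF k 1≤k (f k) g f≡∑g g₀-zero g₀-suc (λ r _ → g-zero r) g-suc
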